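{- Let $N$ be a T-net of order $m$ and let the families $W_{m-1}$, $W_m$ and $\Delta$ be as described in the context. Then the sets $\Theta(N)$, $\Theta(\Delta)$, $\Theta(W_{m-1})$ and $\Theta(W_m)$ are pairwise in bijection.
   Context: A T-net of order $m$ is a finite directed multigraph (loops and parallel edges allowed) with $m$ nodes and $2m$ edges in which every node has indegree $2$ and outdegree $2$. Let $N$ be a T-net of order $m$ with node set $U(N)$. Quadruple $\hat N$: for every edge $e$ of $N$ create two nodes $e^-$, $e^+$ and a black edge from $e^-$ to $e^+$. For every node $a\in U(N)$ with incoming edges $e_1,e_2$ and outgoing edges $f_1,f_2$, create the four blue edges $e_j^+\to f_k^-$ ($j,k\in\{1,2\}$); let $\Pi(a)$ be this set. Eulerian cycles: in a graph whose edges are colored black or blue, an Eulerian cycle is a closed walk traversing every blue edge exactly once and every black edge exactly twice (in a graph with a single edge color, such as $N$, every edge exactly once). Eulerian cycles are cyclic sequences of edges identified up to rotation. $\Theta(X)$ denotes the set of Eulerian cycles of a graph $X$, and for a family $Y$ of graphs $\Theta(Y)$ is the disjoint union of $\Theta(X)$ over members $X$ of $Y$. Two edges are incident if they share an endpoint (orientation ignored). For each $a\in U(N)$, fix a labeling of $\Pi(a)$ as $t_a,u_a,v_a,z_a$ with $t_a,v_a$ not incident (hence $u_a,z_a$ not incident). For a graph $w$ containing the blue edges of $\Pi(a)$, $\dot w^{(a)}$ is obtained by removing $t_a,v_a$ and recoloring $u_a,z_a$ black, and $\ddot w^{(a)}$ by removing $u_a,z_a$ and recoloring $t_a,v_a$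 black. Fix a bijection $\phi:\{1,\dots,m\}\to U(N)$. Let $W_0=(\hat N)$ and for $i=1,\dots,m$ let $W_i$ be the family (with multiplicity) of $\dot w^{(\phi(i))}$, $\ddot w^{(\phi(i))}$ over all members $w$ of $W_{i-1}$. Let $\Delta$ be the subfamily of members of $W_m$ that are connected (as undirected graphs). -}

module Defs where

open import Level using (0ℓ)
open import Data.Nat using (ℕ; zero; suc; _*_; _≤_; _<_)
open import Data.Nat.Properties using (<⇒≤; ≤-refl)
open import Data.Fin using (Fin; fromℕ<)
open import Data.Fin.Properties using () renaming (_≟_ to _≟F_)
open import Data.Bool using (Bool; true; false; if_then_else_; _∨_)
open import Data.Vec using (Vec; []; _∷_)
open import Data.List using (List; []; _∷_; _∷ʳ_; length; filter; allFin)
open import Data.Product using (Σ; _×_; _,_; proj₁; proj₂)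
open import Data.Product.Properties using (≡-dec)
open import Data.Sum using (_⊎_)
open import Data.Unit using (⊤)
open import Relation.Nullary using (¬_; yes; no; does)
open import Relation.Binary using (Setoid; DecidableEquality; Rel)
open import Relation.Binary.PropositionalEquality using (_≡_; _≢_; refl; cong; cong₂)
import Relation.Binary.Construct.Closure.Equivalence as EqC
open import Relation.Binary.Construct.Closure.ReflexiveTransitive using (Star)
open import Function.Bundles using (_⤖_; Bijection)

-- Generic directed multigraphs given by an edge type E, vertex type V,
-- source/target maps.  Closed walks are lists e₀ … e_{k-1} with
-- tgt eᵢ ≡ src eᵢ₊₁ (indices mod k).

module _ {E V : Set} (src tgt : E → V) where

  ChainFrom : V → E → List E → Set
  ChainFrom s x []       = tgt x ≡ s
  ChainFrom s x (y ∷ ys) = tgt x ≡ src y × ChainFrom s y ys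

  ClosedWalk : List E → Set
  ClosedWalk []       = ⊤
  ClosedWalk (x ∷ xs) = ChainFrom (src x) x xs

count : {E : Set} → DecidableEquality E → E → List E → ℕ
count _≟_ e ws = length (filter (e ≟_) ws)

-- Eulerian cycle (as a list) where edge e must be traversed exactly
-- (req e) times (1 for uncoloured/blue edges, 2 for black, 0 for absent)
IsEulerian : {E V : Set} → DecidableEquality E → (src tgt : E → V) →
             (E → ℕ) → List E → Set
IsEulerian _≟_ src tgt req ws =
  ClosedWalk src tgt ws × (∀ e → count _≟_ e ws ≡ req e)

RotStep : {E : Set} → Rel (List E) 0ℓ
RotStep {E} ws ws' = Σ E λ x → Σ (List E) λ xs → ws ≡ x ∷ xs × ws' ≡ xs ∷ʳ x

Θ : {E V : Set} → DecidableEquality E → (src tgt : E → V) → (E → ℕ) → Setoid 0ℓ 0ℓ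
Θ {E} _≟_ src tgt req = EqC.setoid {A = Σ (List E) (IsEulerian _≟_ src tgt req)}
  (λ c c' → RotStep (proj₁ c) (proj₁ c'))

-- Θ(Y) for the family Y = (X_i)_{i ∈ I, P i}: the disjoint union of
-- the Θ(X_i); cycles identified up to rotation inside one member.
ΘFam : {E V : Set} → DecidableEquality E → (src tgt : E → V) →
       (I : Set) → (P : I → Set) → (I → E → ℕ) → Setoid 0ℓ 0ℓ
ΘFam {E} _≟_ src tgt I P req =
  EqC.setoid {A = Σ I λ i → P i × Σ (List E) (IsEulerian _≟_ src tgt (req i))}
    (λ { (i , _ , ws , _) (j , _ , ws' , _) → i ≡ j × RotStep ws ws' })

record TNet (m : ℕ) : Set where
  field
    src tgt : Fin (2 * m) → Fin m
    indeg  : ∀ a → length (filter (λ e → tgt e ≟F a) (allFin (2 * m))) ≡ 2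
    outdeg : ∀ a → length (filter (λ e → src e ≟F a) (allFin (2 * m))) ≡ 2

-- The quadruple: nodes e⁻, e⁺; black edge e⁻ → e⁺; blue edge
-- (e , f) : e⁺ → f⁻ whenever tgt e ≡ src f (i.e. both at node a).

data Sign : Set where
  minus plus : Sign

data QEdge (m : ℕ) : Set where
  black : Fin (2 * m) → QEdge m
  blue  : Fin (2 * m) → Fin (2 * m) → QEdge m

QVertex : ℕ → Set
QVertex m = Fin (2 * m) × Sign

qsrc qtgt : ∀ {m} → QEdge m → QVertex m
qsrc (black e)  = e , minus
qsrc (blue e f) = e , plus
qtgt (black e)  = e , plus
qtgt (blue e f) = f , minus

_≟Q_ : ∀ {m} → DecidableEquality (QEdge m)
black e ≟Q black e' with e ≟F e'
... | yes refl = yes refl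
... | no ne = no λ { refl → ne refl }
black e ≟Q blue _ _ = no λ ()
blue _ _ ≟Q black _ = no λ ()
blue e f ≟Q blue e' f' with e ≟F e' | f ≟F f'
... | yes refl | yes refl = yes refl
... | no ne | _ = no λ { refl → ne refl }
... | _ | no nf = no λ { refl → nf refl }

Incident : ∀ {m} → QEdge m → QEdge m → Set
Incident q q' = (qsrc q ≡ qsrc q') ⊎ (qsrc q ≡ qtgt q') ⊎ (qtgt q ≡ qsrc q') ⊎ (qtgt q ≡ qtgt q')

data Colour : Set where
  absent blk blu : Colour

mult : Colour → ℕ
mult absent = 0
mult blk    = 2
mult blu    = 1

Colouring : ℕ → Set
Colouring m = QEdge m → Colour

Adj : ∀ {m} → Colouring m → Rel (QVertex m) 0ℓ
Adj c x y = Σ _ λ q → c q ≢ absent × ((qsrc q ≡ x × qtgt q ≡ y) ⊎ (qtgt q ≡ x × qsrc q ≡ y))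

Connected : ∀ {m} → Colouring m → Set
Connected c = ∀ x y → Star (Adj c) x y

module _ {m : ℕ} (N : TNet m) where
  open TNet N

  InΠ : Fin m → Fin (2 * m) × Fin (2 * m) → Set
  InΠ a (e , f) = tgt e ≡ a × src f ≡ a

  blueE : Fin (2 * m) × Fin (2 * m) → QEdge m
  blueE (e , f) = blue e f

  record Labelling (a : Fin m) : Set where
    field
      t u v z : Fin (2 * m) × Fin (2 * m)
      t∈ : InΠ a t
      u∈ : InΠ a u
      v∈ : InΠ a v
      z∈ : InΠ a z
      t≢u : t ≢ u
      t≢v : t ≢ v
      t≢z : t ≢ z
      u≢v : u ≢ v
      u≢z : u ≢ z
      v≢z : v ≢ z
      t-v-not-incident : ¬ Incident (blueE t) (blueE v)

  c₀ : Colouring m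
  c₀ (black e)  = blk
  c₀ (blue e f) = if does (tgt e ≟F src f) then blu else absent

module Construction {m : ℕ} (N : TNet m) (L : ∀ a → Labelling N a)
                    (φ : Fin m ⤖ Fin m) where
  open TNet N

  _≟P_ : DecidableEquality (Fin (2 * m) × Fin (2 * m))
  _≟P_ = ≡-dec _≟F_ _≟F_

  -- op a true c = ẇ^(a) (remove t,v; u,z black);
  -- op a false c = ẅ^(a) (remove u,z; t,v black)
  op : Fin m → Bool → Colouring m → Colouring m
  op a b c (black e)  = c (black e)
  op a b c (blue e f) =
    if does ((e , f) ≟P t) ∨ does ((e , f) ≟P v) then (if b then absent else blk)
    else if does ((e , f) ≟P u) ∨ does ((e , f) ≟P z) then (if b then blk else absent)
    else c (blue e f)
    where open Labelling (L a)

  φ' : Fin m → Fin m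
  φ' = Bijection.to φ

  -- member of W_i indexed by the choice vector (head = choice at step i)
  Wc : (i : ℕ) → i ≤ m → Vec Bool i → Colouring m
  Wc zero    _ []       = c₀ N
  Wc (suc i) p (b ∷ bs) = op (φ' (fromℕ< p)) b (Wc i (<⇒≤ p) bs)

  ΘN : Setoid 0ℓ 0ℓ
  ΘN = Θ _≟F_ src tgt (λ _ → 1)

  ΘW : (i : ℕ) → i ≤ m → Setoid 0ℓ 0ℓ
  ΘW i p = ΘFam _≟Q_ qsrc qtgt (Vec Bool i) (λ _ → ⊤) (λ bs q → mult (Wc i p bs q))

  ΘΔ : Setoid 0ℓ 0ℓ
  ΘΔ = ΘFam _≟Q_ qsrc qtgt (Vec Bool m) (λ bs → Connected (Wc m ≤-refl bs))
         (λ bs q → mult (Wc m ≤-refl bs q))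

module Submission where

-- Each of the four sets is classified by the connected members of W_m.  A member of W_m splits every
-- node of N in one of its two ways, i.e. fixes a successor permutation s of the edges of N; it is the
-- union of the black cycles along the orbits of s, so it is connected iff s is cyclic, and then its only
-- Eulerian cycle (up to rotation) is that cycle traversed twice.  An Eulerian cycle of N determines at
-- every node which way it passes, and its cyclic successor is the resulting s.  In a member of W_{m-1}
-- only a⋆ = φ(m) is unsplit; read from the edge t_a⋆, an Eulerian cycle is cut by the edges of Π(a⋆)
-- into walks avoiding Π(a⋆), which are forced by their starting vertex, and the only two consistent
-- patterns are t S₁ (crossing) S₂ v S₂ (crossing) S₁ and t S₁ (crossing) S₁ v S₂ (crossing) S₂, which say
-- that splitting a⋆ in the corresponding way yields a connected member of W_m.

open import Defs
open import Data.Nat using (ℕ; _≤_; _∸_)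
open import Data.Nat.Properties using (m∸n≤m; ≤-refl)
open import Data.Fin using (Fin)
open import Data.Product using (_×_)
open import Function.Bundles using (_⤖_; Bijection)

open import Level using (0ℓ)
open import Data.Nat using (zero; suc; _+_; _*_; _<_; z≤n; s≤s; s≤s⁻¹; NonZero; >-nonZero; pred)
open import Data.Nat.Properties
open import Data.Nat.DivMod using (_/_; _%_; m≡m%n+[m/n]*n; m%n<n)
open import Data.Nat.GeneralisedArithmetic using (iterate)
open import Data.Nat.Solver using (module +-*-Solver)
import Data.Fin
open import Data.Fin using (toℕ; fromℕ<)
open import Data.Fin.Properties using (toℕ<n; toℕ-fromℕ<; toℕ-injective; pigeonhole) renaming (_≟_ to _≟F_)
open import Data.List using (List; []; _∷_; _++_; _∷ʳ_; [_]; length; filter; allFin)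
import Data.List as List
open import Data.List.Properties using (++-assoc; ++-identityʳ; filter-++; length-++)
open import Data.List.Membership.Propositional using (_∈_)
open import Data.List.Membership.Propositional.Properties
  using (∈-++⁻; ∈-++⁺ˡ; ∈-++⁺ʳ; ∈-tabulate⁺; ∈-tabulate⁻; ∈-filter⁺; ∈-allFin)
open import Data.List.Relation.Unary.Any using (here; there)
open import Data.List.Relation.Unary.All using (All; []; _∷_)
import Data.List.Relation.Unary.All as All
import Data.List.Relation.Unary.All.Properties as All
open import Data.List.Relation.Unary.AllPairs using (_∷_)
open import Data.List.Relation.Unary.Unique.Propositional using (Unique)
open import Data.List.Relation.Unary.Unique.Propositional.Properties using (tabulate⁺)
import Data.List.Relation.Unary.First as First
open import Data.List.Relation.Unary.First.Properties using (toView)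
open import Data.Product using (Σ; ∃; ∃₂; _,_; proj₁; proj₂)
import Data.Product as Product
open import Data.Sum using (_⊎_; inj₁; inj₂)
import Data.Sum as Sum
open import Data.Unit using (⊤; tt)
open import Data.Empty using (⊥; ⊥-elim)
open import Data.Bool using (Bool; true; false; if_then_else_; not)
open import Data.Maybe using (Maybe; just; nothing)
import Data.Maybe as Maybe
import Data.Maybe.Properties as Maybe
open import Data.Vec using (Vec; []; _∷_)
import Data.Vec.Properties as Vec
open import Function using (id; _∘_; case_of_)
import Function.Construct.Composition as Composition
import Function.Construct.Symmetry as Symmetry
open import Relation.Nullary using (¬_; Dec; yes; no; does)
import Relation.Nullary.Decidable as Dec
open import Relation.Binary using (DecidableEquality; Setoid)
open import Relation.Binary.Definitions using (tri<; tri≈; tri>)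
open import Relation.Binary.PropositionalEquality hiding ([_])
import Relation.Binary.PropositionalEquality as ≡
open import Relation.Binary.Construct.Closure.ReflexiveTransitive using (Star; ε; _◅_; _◅◅_)
import Relation.Binary.Construct.Closure.ReflexiveTransitive as Star
open import Relation.Binary.Construct.Closure.Symmetric using (fwd; bwd)
import Relation.Binary.Construct.On as On

module Counting {A : Set} (_≟_ : DecidableEquality A) where

  cnt : A → List A → ℕ
  cnt = count _≟_

  cnt-here : ∀ x xs → cnt x (x ∷ xs) ≡ suc (cnt x xs)
  cnt-here x xs with x ≟ x
  ... | yes _ = refl
  ... | no x≢x = ⊥-elim (x≢x refl)

  cnt-there : ∀ {x y} xs → x ≢ y → cnt x (y ∷ xs) ≡ cnt x xs
  cnt-there {x} {y} xs x≢y with x ≟ y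
  ... | yes x≡y = ⊥-elim (x≢y x≡y)
  ... | no _ = refl

  cnt-++ : ∀ x xs ys → cnt x (xs ++ ys) ≡ cnt x xs + cnt x ys
  cnt-++ x xs ys = trans (cong length (filter-++ (x ≟_) xs ys)) (length-++ (filter (x ≟_) xs))

  cnt-++-comm : ∀ x xs ys → cnt x (xs ++ ys) ≡ cnt x (ys ++ xs)
  cnt-++-comm x xs ys = begin
    cnt x (xs ++ ys)      ≡⟨ cnt-++ x xs ys ⟩
    cnt x xs + cnt x ys   ≡⟨ +-comm (cnt x xs) (cnt x ys) ⟩
    cnt x ys + cnt x xs   ≡⟨ cnt-++ x ys xs ⟨
    cnt x (ys ++ xs)      ∎
    where open ≡-Reasoning

  cnt-∷ʳ : ∀ x xs y → cnt x (xs ∷ʳ y) ≡ cnt x (y ∷ xs)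
  cnt-∷ʳ x xs y = cnt-++-comm x xs [ y ]

  cnt-≤-++ : ∀ x xs ys → cnt x ys ≤ cnt x (xs ++ ys)
  cnt-≤-++ x xs ys = subst (cnt x ys ≤_) (sym (cnt-++ x xs ys)) (m≤n+m (cnt x ys) (cnt x xs))

  ∈⇒1≤cnt : ∀ {x xs} → x ∈ xs → 1 ≤ cnt x xs
  ∈⇒1≤cnt {x} {_ ∷ xs} (here refl) = subst (1 ≤_) (sym (cnt-here x xs)) (s≤s z≤n)
  ∈⇒1≤cnt {x} {y ∷ _} (there x∈xs) with x ≟ y
  ... | yes _ = s≤s z≤n
  ... | no _ = ∈⇒1≤cnt x∈xs

  1≤cnt⇒∈ : ∀ {x xs} → 1 ≤ cnt x xs → x ∈ xs
  1≤cnt⇒∈ {x} {y ∷ xs} 1≤cnt with x ≟ y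
  ... | yes refl = here refl
  ... | no _ = there (1≤cnt⇒∈ 1≤cnt)

  cnt≡1⇒∈ : ∀ {x xs} → cnt x xs ≡ 1 → x ∈ xs
  cnt≡1⇒∈ cnt≡1 = 1≤cnt⇒∈ (≤-reflexive (sym cnt≡1))

  cnt≡2⇒∈ : ∀ {x xs} → cnt x xs ≡ 2 → x ∈ xs
  cnt≡2⇒∈ cnt≡2 = 1≤cnt⇒∈ (subst (1 ≤_) (sym cnt≡2) (s≤s z≤n))

  ∈⇒2≤cnt : ∀ x xs ys → x ∈ ys → 2 ≤ cnt x (xs ++ x ∷ ys)
  ∈⇒2≤cnt x xs ys x∈ys = ≤-trans (subst (2 ≤_) (sym (cnt-here x ys)) (s≤s (∈⇒1≤cnt x∈ys)))
                                 (cnt-≤-++ x xs (x ∷ ys))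

  cnt≡0 : ∀ {P : A → Set} {x xs} → All (λ y → ¬ P y) xs → P x → cnt x xs ≡ 0
  cnt≡0 {x = x} {xs} none Px with cnt x xs in eq
  ... | zero = refl
  ... | suc _ = ⊥-elim (All.lookup none (1≤cnt⇒∈ (subst (1 ≤_) (sym eq) (s≤s z≤n))) Px)

  first-occurrence : ∀ {x xs} → x ∈ xs → ∃₂ λ ys zs → xs ≡ ys ++ x ∷ zs × cnt x ys ≡ 0
  first-occurrence {x} {y ∷ xs} x∈ with x ≟ y
  ... | yes refl = [] , xs , refl , refl
  first-occurrence {x} {y ∷ xs} (here x≡y) | no x≢y = ⊥-elim (x≢y x≡y)
  first-occurrence {x} {y ∷ xs} (there x∈) | no x≢y with first-occurrence x∈
  ... | ys , zs , refl , c = y ∷ ys , zs , refl , trans (cnt-there ys x≢y) c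

  cnt-[-] : ∀ {x y} → x ≢ y → cnt x [ y ] ≡ 0
  cnt-[-] = cnt-there []

  cnt-∷ : ∀ x y ys → cnt x (y ∷ ys) ≡ cnt x [ y ] + cnt x ys
  cnt-∷ x y ys = cnt-++ x [ y ] ys

  cnt-blocks : ∀ x a b c d xs ys zs ws → cnt x (a ∷ xs ++ b ∷ ys ++ c ∷ zs ++ d ∷ ws) ≡
               cnt x [ a ] + (cnt x xs + (cnt x [ b ] + (cnt x ys + (cnt x [ c ] + (cnt x zs + (cnt x [ d ] + cnt x ws))))))
  cnt-blocks x a b c d xs ys zs ws =
    trans (cnt-∷ x a _) (cong (cnt x [ a ] +_) (trans (cnt-++ x xs _) (cong (cnt x xs +_)
    (trans (cnt-∷ x b _) (cong (cnt x [ b ] +_) (trans (cnt-++ x ys _) (cong (cnt x ys +_)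
    (trans (cnt-∷ x c _) (cong (cnt x [ c ] +_) (trans (cnt-++ x zs _) (cong (cnt x zs +_) (cnt-∷ x d ws))))))))))))

  cnt-unique : ∀ {x xs} → Unique xs → x ∈ xs → cnt x xs ≡ 1
  cnt-unique {x} {_ ∷ xs} (x∉xs ∷ _) (here refl) =
    trans (cnt-here x xs) (cong suc (cnt≡0 {P = x ≡_} x∉xs refl))
  cnt-unique {x} {y ∷ xs} (y∉xs ∷ u) (there x∈xs) with x ≟ y
  ... | yes refl = ⊥-elim (All.lookup y∉xs x∈xs refl)
  ... | no _ = cnt-unique u x∈xs

module CanonicalRotation {A : Set} (_≟_ : DecidableEquality A) where
  open Counting _≟_

  split-at-first : A → List A → Maybe (List A × List A)
  split-at-first x [] = nothing
  split-at-first x (y ∷ ys) = if does (x ≟ y) then just ([] , ys) else Maybe.map (Product.map₁ (y ∷_)) (split-at-first x ys)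

  rotate-to : A → List A → List A
  rotate-to x ws with split-at-first x ws
  ... | nothing = ws
  ... | just (xs , ys) = x ∷ ys ++ xs

  split-at-first-occurrence : ∀ x xs ys → cnt x xs ≡ 0 → split-at-first x (xs ++ x ∷ ys) ≡ just (xs , ys)
  split-at-first-occurrence x [] ys _ with x ≟ x
  ... | yes _ = refl
  ... | no x≢x = ⊥-elim (x≢x refl)
  split-at-first-occurrence x (y ∷ xs) ys cnt≡0 with x ≟ y
  ... | no _ rewrite split-at-first-occurrence x xs ys cnt≡0 = refl

  rotate-to-first-occurrence : ∀ x xs ys → cnt x xs ≡ 0 → rotate-to x (xs ++ x ∷ ys) ≡ x ∷ ys ++ xs
  rotate-to-first-occurrence x xs ys cnt≡0 rewrite split-at-first-occurrence x xs ys cnt≡0 = refl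

  rotate-to-rotate : ∀ x y ys → cnt x (y ∷ ys) ≡ 1 → rotate-to x (ys ∷ʳ y) ≡ rotate-to x (y ∷ ys)
  rotate-to-rotate x y ys cnt≡1 = by-cases (x ≟ y) cnt≡1
    where
      open ≡-Reasoning
      by-cases : Dec (x ≡ y) → cnt x (y ∷ ys) ≡ 1 → rotate-to x (ys ∷ʳ y) ≡ rotate-to x (y ∷ ys)
      by-cases (yes refl) once = begin
        rotate-to x (ys ∷ʳ x)    ≡⟨ rotate-to-first-occurrence x ys [] (suc-injective (trans (sym (cnt-here x ys)) once)) ⟩
        x ∷ ys                   ≡⟨ cong (x ∷_) (++-identityʳ ys) ⟨
        x ∷ ys ++ []             ≡⟨ rotate-to-first-occurrence x [] ys refl ⟨
        rotate-to x (x ∷ ys)     ∎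
      by-cases (no x≢y) once with first-occurrence {x} {ys} (cnt≡1⇒∈ (trans (sym (cnt-there ys x≢y)) once))
      ... | xs , zs , refl , cnt≡0 = begin
        rotate-to x ((xs ++ x ∷ zs) ∷ʳ y)   ≡⟨ cong (rotate-to x) (++-assoc xs (x ∷ zs) [ y ]) ⟩
        rotate-to x (xs ++ x ∷ zs ∷ʳ y)     ≡⟨ rotate-to-first-occurrence x xs (zs ∷ʳ y) cnt≡0 ⟩
        x ∷ (zs ∷ʳ y) ++ xs                 ≡⟨ cong (x ∷_) (++-assoc zs [ y ] xs) ⟩
        x ∷ zs ++ y ∷ xs                    ≡⟨ rotate-to-first-occurrence x (y ∷ xs) zs (trans (cnt-there xs x≢y) cnt≡0) ⟨
        rotate-to x (y ∷ xs ++ x ∷ zs)      ∎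

-- Orbits of a function

module Orbits {A : Set} (_≟_ : DecidableEquality A) (g : A → A) where
  open Counting _≟_

  iterate-+ : ∀ x i j → iterate g x (i + j) ≡ iterate g (iterate g x i) j
  iterate-+ x zero j = refl
  iterate-+ x (suc i) j = iterate-+ (g x) i j

  iterate-suc : ∀ x i → iterate g x (suc i) ≡ g (iterate g x i)
  iterate-suc x i = trans (cong (iterate g x) (+-comm 1 i)) (iterate-+ x i 1)

  orbit : A → ℕ → List A
  orbit = List.iterate g

  orbit-tabulate : ∀ x k → orbit x k ≡ List.tabulate {n = k} (iterate g x ∘ toℕ)
  orbit-tabulate x zero = refl
  orbit-tabulate x (suc k) = cong (x ∷_) (orbit-tabulate (g x) k)

  ∈-orbit⁻ : ∀ {x k y} → y ∈ orbit x k → ∃ λ i → i < k × iterate g x i ≡ y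
  ∈-orbit⁻ {x} {k} y∈ with ∈-tabulate⁻ (subst (_ ∈_) (orbit-tabulate x k) y∈)
  ... | i , refl = toℕ i , toℕ<n i , refl

  ∈-orbit⁺ : ∀ x {k i} → i < k → iterate g x i ∈ orbit x k
  ∈-orbit⁺ x {k} i<k = subst (_ ∈_) (sym (orbit-tabulate x k))
    (subst (_∈ _) (cong (iterate g x) (toℕ-fromℕ< i<k)) (∈-tabulate⁺ (fromℕ< i<k)))

  orbit-+ : ∀ x i j → orbit x (i + j) ≡ orbit x i ++ orbit (iterate g x i) j
  orbit-+ x zero j = refl
  orbit-+ x (suc i) j = cong (x ∷_) (orbit-+ (g x) i j)

  orbit-∷ʳ : ∀ x k → orbit x (suc k) ≡ orbit x k ∷ʳ iterate g x k
  orbit-∷ʳ x k = trans (cong (orbit x) (+-comm 1 k)) (orbit-+ x k 1)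

  closed⇒orbit : ∀ x xs → ClosedWalk id g (x ∷ xs) →
                 x ∷ xs ≡ orbit x (suc (length xs)) × iterate g x (suc (length xs)) ≡ x
  closed⇒orbit x xs = go x xs
    where
      go : ∀ {s} y ys → ChainFrom id g s y ys → y ∷ ys ≡ orbit y (suc (length ys)) × iterate g y (suc (length ys)) ≡ s
      go y [] gy≡s = refl , gy≡s
      go y (z ∷ zs) (refl , chain) with go z zs chain
      ... | zs≡ , returns = cong (y ∷_) zs≡ , returns

  record MinimalPeriod (x : A) (d : ℕ) : Set where
    field
      1≤d : 1 ≤ d
      returns : iterate g x d ≡ x
      minimal : ∀ {i} → 1 ≤ i → i < d → iterate g x i ≢ x

  orbit-minimal-period : ∀ {x k} → 1 ≤ k → iterate g x k ≡ x → cnt x (orbit x k) ≡ 1 → MinimalPeriod x k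
  orbit-minimal-period {x} {suc k} 1≤k back once = record { 1≤d = 1≤k ; returns = back ; minimal = minimal′ }
    where
      minimal′ : ∀ {i} → 1 ≤ i → i < suc k → iterate g x i ≢ x
      minimal′ {suc i} _ (s≤s i<k) back′ = <⇒≢ (s≤s (∈⇒1≤cnt x∈)) (sym (trans (sym (cnt-here x _)) once))
        where
          x∈ : x ∈ orbit (g x) k
          x∈ = subst (_∈ orbit (g x) k) back′ (∈-orbit⁺ (g x) i<k)

  minimal-period-unique : ∀ {x d d′} → MinimalPeriod x d → MinimalPeriod x d′ → d ≡ d′
  minimal-period-unique {d = d} {d′} p p′ with <-cmp d d′
  ... | tri< d<d′ _ _ = ⊥-elim (MinimalPeriod.minimal p′ (MinimalPeriod.1≤d p) d<d′ (MinimalPeriod.returns p))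
  ... | tri≈ _ d≡d′ _ = d≡d′
  ... | tri> _ _ d′<d = ⊥-elim (MinimalPeriod.minimal p (MinimalPeriod.1≤d p′) d′<d (MinimalPeriod.returns p′))

  minimal-period-exists : ∀ {x r} → 1 ≤ r → iterate g x r ≡ x → ∃ (MinimalPeriod x)
  minimal-period-exists {x} {suc r} _ returns = search 0 r (λ { {zero} () ; {suc _} _ () }) returns
    where
      search : ∀ i δ → (∀ {j} → 1 ≤ j → j ≤ i → iterate g x j ≢ x) → iterate g x (suc i + δ) ≡ x → ∃ (MinimalPeriod x)
      search i δ below back with iterate g x (suc i) ≟ x
      ... | yes back′ = suc i , record { 1≤d = s≤s z≤n ; returns = back′ ; minimal = λ 1≤j j<1+i → below 1≤j (s≤s⁻¹ j<1+i) }
      search i zero below back | no not-here = ⊥-elim (not-here (trans (cong (iterate g x) (sym (+-identityʳ (suc i)))) back))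
      search i (suc δ) below back | no not-here =
        search (suc i) δ below′ (trans (cong (iterate g x) (sym (+-suc (suc i) δ))) back)
        where
          below′ : ∀ {j} → 1 ≤ j → j ≤ suc i → iterate g x j ≢ x
          below′ 1≤j j≤1+i with m≤n⇒m<n∨m≡n j≤1+i
          ... | inj₁ j<1+i = below 1≤j (s≤s⁻¹ j<1+i)
          ... | inj₂ refl = not-here

  module _ {x d} (period : MinimalPeriod x d) where
    open MinimalPeriod period

    iterate-distinct : ∀ {i j} → i < j → j < d → iterate g x i ≢ iterate g x j
    iterate-distinct {i} {j} i<j j<d eq = minimal (≤-trans (m<n⇒0<n∸m j<d) (m≤n+m (d ∸ j) i)) shift<d shift-returns
      where
        shift<d : i + (d ∸ j) < d
        shift<d = subst (i + (d ∸ j) <_) (m+[n∸m]≡n (<⇒≤ j<d)) (+-monoˡ-< (d ∸ j) i<j)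
        shift-returns : iterate g x (i + (d ∸ j)) ≡ x
        shift-returns = begin
          iterate g x (i + (d ∸ j))              ≡⟨ iterate-+ x i (d ∸ j) ⟩
          iterate g (iterate g x i) (d ∸ j)      ≡⟨ cong (λ y → iterate g y (d ∸ j)) eq ⟩
          iterate g (iterate g x j) (d ∸ j)      ≡⟨ iterate-+ x j (d ∸ j) ⟨
          iterate g x (j + (d ∸ j))              ≡⟨ cong (iterate g x) (m+[n∸m]≡n (<⇒≤ j<d)) ⟩
          iterate g x d                          ≡⟨ returns ⟩
          x                                      ∎
          where open ≡-Reasoning

    iterate-injective : ∀ {i j} → i < d → j < d → iterate g x i ≡ iterate g x j → i ≡ j
    iterate-injective {i} {j} i<d j<d eq with <-cmp i j
    ... | tri< i<j _ _ = ⊥-elim (iterate-distinct i<j j<d eq)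
    ... | tri≈ _ i≡j _ = i≡j
    ... | tri> _ _ j<i = ⊥-elim (iterate-distinct j<i i<d (sym eq))

    cnt-orbit : ∀ {y} → y ∈ orbit x d → cnt y (orbit x d) ≡ 1
    cnt-orbit = cnt-unique (subst Unique (sym (orbit-tabulate x d))
      (tabulate⁺ (λ eq → toℕ-injective (iterate-injective (toℕ<n _) (toℕ<n _) eq))))

    iterate-* : ∀ q → iterate g x (q * d) ≡ x
    iterate-* zero = refl
    iterate-* (suc q) = trans (iterate-+ x d (q * d)) (trans (cong (λ y → iterate g y (q * d)) returns) (iterate-* q))

    period-divides : ∀ {ℓ} → iterate g x ℓ ≡ x → ∃ λ q → ℓ ≡ q * d
    period-divides {ℓ} back = ℓ / d , ℓ≡
      where
        instance
          d≢0 : NonZero d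
          d≢0 = >-nonZero 1≤d
        ℓ≡r+qd : ℓ ≡ ℓ % d + (ℓ / d) * d
        ℓ≡r+qd = m≡m%n+[m/n]*n ℓ d
        remainder-returns : iterate g x (ℓ % d) ≡ x
        remainder-returns = begin
          iterate g x (ℓ % d)                                ≡⟨ cong (λ y → iterate g y (ℓ % d)) (iterate-* (ℓ / d)) ⟨
          iterate g (iterate g x ((ℓ / d) * d)) (ℓ % d)      ≡⟨ iterate-+ x ((ℓ / d) * d) (ℓ % d) ⟨
          iterate g x ((ℓ / d) * d + ℓ % d)                  ≡⟨ cong (iterate g x) (trans (+-comm ((ℓ / d) * d) (ℓ % d)) (sym ℓ≡r+qd)) ⟩
          iterate g x ℓ                                      ≡⟨ back ⟩
          x                                                  ∎
          where open ≡-Reasoning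
        ℓ≡ : ℓ ≡ (ℓ / d) * d
        ℓ≡ with ℓ % d in r≡
        ... | zero = trans ℓ≡r+qd (cong (_+ (ℓ / d) * d) r≡)
        ... | suc _ = ⊥-elim (minimal (s≤s z≤n) (subst (_< d) r≡ (m%n<n ℓ d)) (subst (λ r → iterate g x r ≡ x) r≡ remainder-returns))

    cnt-orbit-* : ∀ q → cnt x (orbit x (q * d)) ≡ q
    cnt-orbit-* zero = refl
    cnt-orbit-* (suc q) = begin
      cnt x (orbit x (d + q * d))                              ≡⟨ cong (cnt x) (orbit-+ x d (q * d)) ⟩
      cnt x (orbit x d ++ orbit (iterate g x d) (q * d))       ≡⟨ cnt-++ x (orbit x d) _ ⟩
      cnt x (orbit x d) + cnt x (orbit (iterate g x d) (q * d)) ≡⟨ cong₂ _+_ (cnt-orbit (∈-orbit⁺ x 1≤d)) (cong (λ y → cnt x (orbit y (q * d))) returns) ⟩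
      1 + cnt x (orbit x (q * d))                              ≡⟨ cong suc (cnt-orbit-* q) ⟩
      suc q                                                    ∎
      where open ≡-Reasoning

module _ {A : Set} (_≟_ : DecidableEquality A) {g h : A → A} (g≗h : ∀ x → g x ≡ h x) where

  iterate-cong : ∀ x i → iterate g x i ≡ iterate h x i
  iterate-cong x zero = refl
  iterate-cong x (suc i) = trans (cong (λ y → iterate g y i) (g≗h x)) (iterate-cong (h x) i)

  orbit-cong : ∀ x i → List.iterate g x i ≡ List.iterate h x i
  orbit-cong x zero = refl
  orbit-cong x (suc i) = cong (x ∷_) (trans (cong (λ y → List.iterate g y i) (g≗h x)) (orbit-cong (h x) i))

  minimal-period-cong : ∀ {x d} → Orbits.MinimalPeriod _≟_ g x d → Orbits.MinimalPeriod _≟_ h x d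
  minimal-period-cong {x} {d} p = record
    { 1≤d = 1≤d ; returns = trans (sym (iterate-cong x d)) returns
    ; minimal = λ {i} 1≤i i<d back → minimal 1≤i i<d (trans (iterate-cong x i) back) }
    where open Orbits.MinimalPeriod p

module _ {n} (g : Fin n → Fin n) (g-injective : ∀ {a b} → g a ≡ g b → a ≡ b) where
  open Orbits _≟F_ g

  iterate-injective-start : ∀ i {a b} → iterate g a i ≡ iterate g b i → a ≡ b
  iterate-injective-start zero eq = eq
  iterate-injective-start (suc i) eq = g-injective (iterate-injective-start i eq)

  injection-periodic : ∀ x → ∃ (MinimalPeriod x)
  injection-periodic x with pigeonhole ≤-refl (λ (i : Fin (suc n)) → iterate g x (toℕ i))
  ... | i , j , i<j , eq = minimal-period-exists (m<n⇒0<n∸m i<j) (sym (iterate-injective-start (toℕ i) shifted))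
    where
      r : ℕ
      r = toℕ j ∸ toℕ i
      shifted : iterate g x (toℕ i) ≡ iterate g (iterate g x r) (toℕ i)
      shifted = trans eq (trans (cong (iterate g x) (sym (m∸n+n≡m (<⇒≤ i<j)))) (iterate-+ x r (toℕ i)))

-- Walks and Eulerian cycles

module Adjacency {A : Set} where

  data Adjacent (e f : A) : List A → Set where
    here  : ∀ {xs} → Adjacent e f (e ∷ f ∷ xs)
    there : ∀ {x xs} → Adjacent e f xs → Adjacent e f (x ∷ xs)

  adjacent? : DecidableEquality A → ∀ e f xs → Dec (Adjacent e f xs)
  adjacent? _≟_ e f [] = no λ ()
  adjacent? _≟_ e f (x ∷ []) = no λ { (there ()) }
  adjacent? _≟_ e f (x ∷ y ∷ xs) with e ≟ x | f ≟ y | adjacent? _≟_ e f (y ∷ xs)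
  ... | yes refl | yes refl | _ = yes here
  ... | _ | _ | yes adj = yes (there adj)
  ... | no e≢x | _ | no ¬adj = no λ { here → e≢x refl ; (there adj) → ¬adj adj }
  ... | yes _ | no f≢y | no ¬adj = no λ { here → f≢y refl ; (there adj) → ¬adj adj }

  adjacent-snd∈ : ∀ {e f x xs} → Adjacent e f (x ∷ xs) → f ∈ xs
  adjacent-snd∈ here = here refl
  adjacent-snd∈ (there {xs = _ ∷ _} adj) = there (adjacent-snd∈ adj)

  adjacent-fst∈ : ∀ {e f xs} y → Adjacent e f (xs ∷ʳ y) → e ∈ xs
  adjacent-fst∈ {xs = _ ∷ _ ∷ _} y here = here refl
  adjacent-fst∈ {xs = _ ∷ []} y (there (there ()))
  adjacent-fst∈ {xs = _ ∷ []} y here = here refl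
  adjacent-fst∈ {xs = _ ∷ _ ∷ _} y (there adj) = there (adjacent-fst∈ y adj)
  adjacent-fst∈ {xs = []} y (there ())

  adjacent-∃ : ∀ {e xs} y → e ∈ xs → ∃ λ f → Adjacent e f (xs ∷ʳ y)
  adjacent-∃ {xs = x ∷ []} y (here refl) = y , here
  adjacent-∃ {xs = x ∷ x′ ∷ xs} y (here refl) = x′ , here
  adjacent-∃ {xs = x ∷ x′ ∷ xs} y (there e∈) with adjacent-∃ y e∈
  ... | f , adj = f , there adj

  adjacent⇒closed : (g : A → A) → ∀ x xs → (∀ {e f} → Adjacent e f (x ∷ xs ∷ʳ x) → f ≡ g e) → ClosedWalk id g (x ∷ xs)
  adjacent⇒closed g x xs = go x xs
    where
      go : ∀ {s} y ys → (∀ {e f} → Adjacent e f (y ∷ ys ∷ʳ s) → f ≡ g e) → ChainFrom id g s y ys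
      go y [] follows = sym (follows here)
      go y (z ∷ zs) follows = sym (follows here) , go z zs (follows ∘ there)

  orbit-adjacent : (g : A → A) → ∀ x k {e f} → Adjacent e f (List.iterate g x k) → f ≡ g e
  orbit-adjacent g x (suc (suc k)) here = refl
  orbit-adjacent g x (suc k) (there adj) = orbit-adjacent g (g x) k adj

  module _ (_≟_ : DecidableEquality A) where
    open Counting _≟_

    private
      cnt≡1⇒∉ : ∀ {x xs} → cnt x (x ∷ xs) ≡ 1 → x ∈ xs → ⊥
      cnt≡1⇒∉ {x} {xs} cnt≡1 x∈xs = <⇒≢ (∈⇒1≤cnt x∈xs) (sym (suc-injective (trans (sym (cnt-here x xs)) cnt≡1)))

    adjacent-injective : ∀ {e e′ f x xs} → Adjacent e f (x ∷ xs) → Adjacent e′ f (x ∷ xs) → cnt f xs ≡ 1 → e ≡ e′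
    adjacent-injective here here _ = refl
    adjacent-injective here (there adj) c = ⊥-elim (cnt≡1⇒∉ c (adjacent-snd∈ adj))
    adjacent-injective (there adj) here c = ⊥-elim (cnt≡1⇒∉ c (adjacent-snd∈ adj))
    adjacent-injective {f = f} {xs = y ∷ ys} (there adj) (there adj′) c with f ≟ y
    ... | yes refl = ⊥-elim (<⇒≢ (∈⇒1≤cnt (adjacent-snd∈ adj)) (sym (suc-injective c)))
    ... | no _ = adjacent-injective adj adj′ c

    adjacent-functional : ∀ {e f f′ xs} y → Adjacent e f (xs ∷ʳ y) → Adjacent e f′ (xs ∷ʳ y) → cnt e xs ≡ 1 → f ≡ f′
    adjacent-functional {xs = _ ∷ []} y here here _ = refl
    adjacent-functional {xs = _ ∷ _ ∷ _} y here here _ = refl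
    adjacent-functional {xs = _ ∷ []} y _ (there (there ())) _
    adjacent-functional {xs = _ ∷ []} y (there (there ())) _ _
    adjacent-functional {xs = _ ∷ _ ∷ _} y here (there adj) c = ⊥-elim (cnt≡1⇒∉ c (adjacent-fst∈ y adj))
    adjacent-functional {xs = _ ∷ _ ∷ _} y (there adj) here c = ⊥-elim (cnt≡1⇒∉ c (adjacent-fst∈ y adj))
    adjacent-functional {e = e} {xs = x ∷ x′ ∷ xs} y (there adj) (there adj′) c with e ≟ x
    ... | yes refl = ⊥-elim (<⇒≢ (∈⇒1≤cnt (adjacent-fst∈ {xs = x′ ∷ xs} y adj)) (sym (suc-injective c)))
    ... | no _ = adjacent-functional {xs = x′ ∷ xs} y adj adj′ c

module Walks {E V : Set} (src tgt : E → V) where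

  Walk : V → List E → V → Set
  Walk v [] w = v ≡ w
  Walk v (q ∷ qs) w = src q ≡ v × Walk (tgt q) qs w

  walk-++ : ∀ {u v w} qs rs → Walk u qs v → Walk v rs w → Walk u (qs ++ rs) w
  walk-++ [] rs refl walk = walk
  walk-++ (q ∷ qs) rs (src≡ , walk) walk′ = src≡ , walk-++ qs rs walk walk′

  walk-++⁻ : ∀ {u w} qs rs → Walk u (qs ++ rs) w → ∃ λ v → Walk u qs v × Walk v rs w
  walk-++⁻ [] rs walk = _ , refl , walk
  walk-++⁻ (q ∷ qs) rs (src≡ , walk) with walk-++⁻ qs rs walk
  ... | v , walk₁ , walk₂ = v , (src≡ , walk₁) , walk₂

  walk-split : ∀ {u w} qs q rs → Walk u (qs ++ q ∷ rs) w → Walk u qs (src q) × Walk (tgt q) rs w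
  walk-split qs q rs walk with walk-++⁻ qs (q ∷ rs) walk
  ... | _ , walk₁ , (refl , walk₂) = walk₁ , walk₂

  chain⇒walk : ∀ {s} x xs → ChainFrom src tgt s x xs → Walk (tgt x) xs s
  chain⇒walk x [] tgt≡ = tgt≡
  chain⇒walk x (y ∷ ys) (tgt≡ , chain) = sym tgt≡ , chain⇒walk y ys chain

  walk⇒chain : ∀ {s} x xs → Walk (tgt x) xs s → ChainFrom src tgt s x xs
  walk⇒chain x [] tgt≡ = tgt≡
  walk⇒chain x (y ∷ ys) (src≡ , walk) = sym src≡ , walk⇒chain y ys walk

  closed⇒walk : ∀ x xs → ClosedWalk src tgt (x ∷ xs) → Walk (src x) (x ∷ xs) (src x)
  closed⇒walk x xs closed = refl , chain⇒walk x xs closed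

  walk⇒closed : ∀ {v} xs → Walk v xs v → ClosedWalk src tgt xs
  walk⇒closed [] _ = tt
  walk⇒closed (x ∷ xs) (refl , walk) = walk⇒chain x xs walk

  closed-++-comm : ∀ xs ys → ClosedWalk src tgt (xs ++ ys) → ClosedWalk src tgt (ys ++ xs)
  closed-++-comm [] ys closed = subst (ClosedWalk src tgt) (sym (++-identityʳ ys)) closed
  closed-++-comm (x ∷ xs) [] closed = subst (ClosedWalk src tgt) (++-identityʳ (x ∷ xs)) closed
  closed-++-comm (x ∷ xs) (y ∷ ys) closed with walk-++⁻ (x ∷ xs) (y ∷ ys) (closed⇒walk x (xs ++ y ∷ ys) closed)
  ... | _ , walk₁ , (refl , walk₂) = walk⇒closed (y ∷ ys ++ x ∷ xs) (walk-++ (y ∷ ys) (x ∷ xs) (refl , walk₂) walk₁)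

  open Adjacency

  closed⇒adjacent-linked : ∀ {e f} x xs → ClosedWalk src tgt (x ∷ xs) → Adjacent e f (x ∷ xs ∷ʳ x) → tgt e ≡ src f
  closed⇒adjacent-linked x xs = go x xs
    where
      go : ∀ {e f s} y ys → ChainFrom src tgt (src s) y ys → Adjacent e f (y ∷ ys ∷ʳ s) → tgt e ≡ src f
      go y [] tgt≡ here = tgt≡
      go y [] _ (there (there ()))
      go y (z ∷ zs) (tgt≡ , _) here = tgt≡
      go y (z ∷ zs) (_ , chain) (there adj) = go z zs chain adj

  orbit-closed : (g : E → E) → (∀ y → src (g y) ≡ tgt y) →
                 ∀ x k → 1 ≤ k → iterate g x k ≡ x → ClosedWalk src tgt (List.iterate g x k)
  orbit-closed g linked x (suc k) _ back = chain x k back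
    where
      chain : ∀ y j → iterate g (g y) j ≡ x → ChainFrom src tgt (src x) y (List.iterate g (g y) j)
      chain y zero gy≡x = trans (sym (linked y)) (cong src gy≡x)
      chain y (suc j) back = sym (linked y) , chain (g y) j back

module Eulerian {E V : Set} (_≟_ : DecidableEquality E) (src tgt : E → V) where
  open Counting _≟_
  open Walks src tgt

  eulerian-++-comm : ∀ {req} xs ys → IsEulerian _≟_ src tgt req (xs ++ ys) → IsEulerian _≟_ src tgt req (ys ++ xs)
  eulerian-++-comm xs ys (closed , counts) =
    closed-++-comm xs ys closed , λ e → trans (cnt-++-comm e ys xs) (counts e)

  eulerian-rotate : ∀ {req} x xs → IsEulerian _≟_ src tgt req (x ∷ xs) → IsEulerian _≟_ src tgt req (xs ∷ʳ x)
  eulerian-rotate x xs = eulerian-++-comm [ x ] xs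

-- Cycles up to rotation, and bijections through a common classification

module Rotations (S : Setoid 0ℓ 0ℓ) {I E : Set} (P : I → List E → Set)
                 (cycle : ∀ i xs → P i xs → Setoid.Carrier S)
                 (P-rotate : ∀ {i x xs} → P i (x ∷ xs) → P i (xs ∷ʳ x))
                 (rotate-≈ : ∀ {i x xs} p q → Setoid._≈_ S (cycle i (x ∷ xs) p) (cycle i (xs ∷ʳ x) q)) where
  open Setoid S using (_≈_) renaming (trans to ≈-trans; sym to ≈-sym)

  -- A rotation step relates two cycles whatever their proofs, so equivalence is stated for all proofs at once.
  RotationEquivalent : I → List E → List E → Set
  RotationEquivalent i xs ys = ∀ p q → cycle i xs p ≈ cycle i ys q

  ≈-resp-≡ : ∀ {i xs xs′ ys ys′} → xs ≡ xs′ → ys ≡ ys′ → RotationEquivalent i xs ys → RotationEquivalent i xs′ ys′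
  ≈-resp-≡ refl refl equiv = equiv

  rotations-≈ : ∀ {i} x xs ys → RotationEquivalent i (x ∷ xs ++ ys) (ys ++ x ∷ xs)
  rotations-≈ x [] ys p q = rotate-≈ p q
  rotations-≈ {i} x (x′ ∷ xs) ys p q = ≈-trans (rotate-≈ p (P-rotate p)) (rest (P-rotate p) q)
    where
      rest : RotationEquivalent i ((x′ ∷ xs ++ ys) ∷ʳ x) (ys ++ x ∷ x′ ∷ xs)
      rest = ≈-resp-≡ (sym (cong (x′ ∷_) (++-assoc xs ys [ x ]))) (++-assoc ys [ x ] (x′ ∷ xs))
                      (rotations-≈ x′ xs (ys ∷ʳ x))

  proof-irrelevant : ∀ {i} x xs → RotationEquivalent i (x ∷ xs) (x ∷ xs)
  proof-irrelevant x xs = ≈-resp-≡ (cong (x ∷_) (++-identityʳ xs)) refl (rotations-≈ x xs [])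

  rotate-to-≈ : ∀ {i} xs x ys → RotationEquivalent i (xs ++ x ∷ ys) (x ∷ ys ++ xs)
  rotate-to-≈ [] x ys = ≈-resp-≡ refl (cong (x ∷_) (sym (++-identityʳ ys))) (proof-irrelevant x ys)
  rotate-to-≈ (y ∷ xs) x ys = rotations-≈ y xs (x ∷ ys)

  RotationEquivalent-sym : ∀ {i xs ys} → RotationEquivalent i xs ys → RotationEquivalent i ys xs
  RotationEquivalent-sym equiv p q = ≈-sym (equiv q p)

  RotationEquivalent-trans : ∀ {i xs ys zs} → P i ys → RotationEquivalent i xs ys → RotationEquivalent i ys zs →
                             RotationEquivalent i xs zs
  RotationEquivalent-trans p-ys equiv equiv′ p q = ≈-trans (equiv p p-ys) (equiv′ p-ys q)

ΘFam-index : ∀ {E V : Set} {_≟_ : DecidableEquality E} {src tgt : E → V} {I P req} {x y} →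
             Setoid._≈_ (ΘFam _≟_ src tgt I P req) x y → proj₁ x ≡ proj₁ y
ΘFam-index ε = refl
ΘFam-index (fwd (i≡j , _) ◅ path) = trans i≡j (ΘFam-index path)
ΘFam-index (bwd (j≡i , _) ◅ path) = trans (sym j≡i) (ΘFam-index path)

record Classification (X C : Setoid 0ℓ 0ℓ) : Set where
  private
    module X = Setoid X
    module C = Setoid C
  field
    class : X.Carrier → C.Carrier
    class-cong : ∀ {x y} → x X.≈ y → class x C.≈ class y
    class-injective : ∀ {x y} → class x C.≈ class y → x X.≈ y
    representative : C.Carrier → X.Carrier
    class-representative : ∀ c → class (representative c) C.≈ c

  bijection : Bijection X C
  bijection = record
    { to = class
    ; cong = class-cong
    ; bijective = class-injective , λ c → representative c , λ x≈ → C.trans (class-cong x≈) (class-representative c)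
    }

  inverse : Bijection C X
  inverse = Symmetry.bijection bijection λ {c} {c′} c≈c′ →
    class-injective (C.trans (class-representative c) (C.trans c≈c′ (C.sym (class-representative c′))))

bijection-via : ∀ {X Y C} → Classification X C → Classification Y C → Bijection X Y
bijection-via cX cY = Composition.bijection (Classification.bijection cX) (Classification.inverse cY)

-- The quadruple and its colourings

exactly-two : ∀ {n} {P : Fin n → Set} (P? : ∀ e → Dec (P e)) → length (filter P? (allFin n)) ≡ 2 →
              ∀ {x y z} → P x → P y → x ≢ y → P z → z ≡ x ⊎ z ≡ y
exactly-two {n} P? two {x} {y} {z} px py x≢y pz
  with filter P? (allFin n) | ∈-filter⁺ P? (∈-allFin x) px | ∈-filter⁺ P? (∈-allFin y) py | ∈-filter⁺ P? (∈-allFin z) pz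
... | _ ∷ _ ∷ [] | here refl | here refl | _ = ⊥-elim (x≢y refl)
... | _ ∷ _ ∷ [] | there (here refl) | there (here refl) | _ = ⊥-elim (x≢y refl)
... | _ ∷ _ ∷ [] | here refl | there (here refl) | here refl = inj₁ refl
... | _ ∷ _ ∷ [] | here refl | there (here refl) | there (here refl) = inj₂ refl
... | _ ∷ _ ∷ [] | there (here refl) | here refl | here refl = inj₂ refl
... | _ ∷ _ ∷ [] | there (here refl) | here refl | there (here refl) = inj₁ refl
exactly-two P? () px py x≢y pz | [] | _ | _ | _
exactly-two P? () px py x≢y pz | _ ∷ [] | _ | _ | _
exactly-two P? () px py x≢y pz | _ ∷ _ ∷ _ ∷ _ | _ | _ | _

Present : ∀ {m} → Colouring m → QEdge m → Set
Present c q = c q ≢ absent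

module _ {m} (c : Colouring m) where
  open Walks (qsrc {m}) qtgt

  private
    reach : ∀ {v w} qs → Walk v qs w → All (Present c) qs → ∀ {q} → q ∈ qs →
            Star (Adj c) v (qsrc q) × Star (Adj c) v (qtgt q)
    reach (q ∷ qs) (refl , _) (present ∷ _) (here refl) = ε , (q , present , inj₁ (refl , refl)) ◅ ε
    reach (q ∷ qs) (refl , walk) (present ∷ all) (there q∈) with reach qs walk all q∈
    ... | to-src , to-tgt = (q , present , inj₁ (refl , refl)) ◅ to-src , (q , present , inj₁ (refl , refl)) ◅ to-tgt

    Adj-sym : ∀ {x y} → Adj c x y → Adj c y x
    Adj-sym (q , present , inj₁ (s≡ , t≡)) = q , present , inj₂ (t≡ , s≡)
    Adj-sym (q , present , inj₂ (t≡ , s≡)) = q , present , inj₁ (s≡ , t≡)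

  closed-walk⇒connected : ∀ xs → ClosedWalk qsrc qtgt xs → All (Present c) xs → (∀ e → black e ∈ xs) → Connected c
  closed-walk⇒connected [] _ _ blacks (e , _) _ = case blacks e of λ ()
  closed-walk⇒connected (x ∷ xs) closed present blacks y z = Star.reverse Adj-sym (from-start y) ◅◅ from-start z
    where
      from-start : ∀ y → Star (Adj c) (qsrc x) y
      from-start (e , minus) = proj₁ (reach (x ∷ xs) (closed⇒walk x xs closed) present (blacks e))
      from-start (e , plus) = proj₂ (reach (x ∷ xs) (closed⇒walk x xs closed) present (blacks e))

  eulerian-present : ∀ {ws} → IsEulerian _≟Q_ qsrc qtgt (mult ∘ c) ws → ∀ {q} → q ∈ ws → Present c q
  eulerian-present (_ , counts) {q} q∈ absent≡ = <⇒≢ (∈⇒1≤cnt q∈) (sym (trans (counts q) (cong mult absent≡)))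
    where open Counting (_≟Q_ {m})

  eulerian⇒connected : (∀ e → c (black e) ≡ blk) → ∀ {ws} → IsEulerian _≟Q_ qsrc qtgt (mult ∘ c) ws → Connected c
  eulerian⇒connected c-black {ws} eul = closed-walk⇒connected ws (proj₁ eul) (All.tabulate (eulerian-present eul))
    (λ e → cnt≡2⇒∈ (trans (proj₂ eul (black e)) (cong mult (c-black e))))
    where open Counting (_≟Q_ {m})

double : ℕ → ℕ
double zero = zero
double (suc j) = suc (suc (double j))

even-or-odd : ∀ i → ∃ λ j → i ≡ double j ⊎ i ≡ suc (double j)
even-or-odd zero = 0 , inj₁ refl
even-or-odd (suc zero) = 0 , inj₂ refl
even-or-odd (suc (suc i)) with even-or-odd i
... | j , inj₁ refl = suc j , inj₁ refl
... | j , inj₂ refl = suc j , inj₂ refl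

double-cancel-< : ∀ {i j} → double i < double j → i < j
double-cancel-< {zero} {suc j} _ = s≤s z≤n
double-cancel-< {suc i} {suc j} (s≤s (s≤s lt)) = s≤s (double-cancel-< lt)

double-mono-< : ∀ {i j} → i < j → suc (double i) < double j
double-mono-< {zero} {suc j} _ = s≤s (s≤s z≤n)
double-mono-< {suc i} {suc j} (s≤s lt) = s≤s (s≤s (double-mono-< lt))

module TNetCycles {k : ℕ} (N : TNet (suc k)) (L : ∀ a → Labelling N a) (φ : Fin (suc k) ⤖ Fin (suc k)) where
  open TNet N
  open Construction N L φ
  open Adjacency using (Adjacent; adjacent?; adjacent-snd∈; adjacent-∃; adjacent-functional; adjacent-injective; adjacent⇒closed; orbit-adjacent)

  m n : ℕ
  m = suc k
  n = 2 * m

  -- Splitting a node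

  module Node (a : Fin m) where
    open Labelling (L a) public

    tx ty vx vy : Fin n
    tx = proj₁ t
    ty = proj₂ t
    vx = proj₁ v
    vy = proj₂ v

    tx≢vx : tx ≢ vx
    tx≢vx e = t-v-not-incident (inj₁ (cong (_, plus) e))

    ty≢vy : ty ≢ vy
    ty≢vy e = t-v-not-incident (inj₂ (inj₂ (inj₂ (cong (_, minus) e))))

    in-edge : ∀ {e} → tgt e ≡ a → e ≡ tx ⊎ e ≡ vx
    in-edge = exactly-two (λ e → tgt e ≟F a) (indeg a) (proj₁ t∈) (proj₁ v∈) tx≢vx

    out-edge : ∀ {f} → src f ≡ a → f ≡ ty ⊎ f ≡ vy
    out-edge = exactly-two (λ e → src e ≟F a) (outdeg a) (proj₂ t∈) (proj₂ v∈) ty≢vy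

    crossing : ∀ {w} → InΠ N a w → w ≢ t → w ≢ v → w ≡ (tx , vy) ⊎ w ≡ (vx , ty)
    crossing (te , sf) w≢t w≢v with in-edge te | out-edge sf
    ... | inj₁ refl | inj₁ refl = ⊥-elim (w≢t refl)
    ... | inj₁ refl | inj₂ refl = inj₁ refl
    ... | inj₂ refl | inj₁ refl = inj₂ refl
    ... | inj₂ refl | inj₂ refl = ⊥-elim (w≢v refl)

    u-z-crossing : (u ≡ (tx , vy) × z ≡ (vx , ty)) ⊎ (u ≡ (vx , ty) × z ≡ (tx , vy))
    u-z-crossing with crossing u∈ (t≢u ∘ sym) u≢v | crossing z∈ (t≢z ∘ sym) (v≢z ∘ sym)
    ... | inj₁ p | inj₁ q = ⊥-elim (u≢z (trans p (sym q)))
    ... | inj₁ p | inj₂ q = inj₁ (p , q)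
    ... | inj₂ p | inj₁ q = inj₂ (p , q)
    ... | inj₂ p | inj₂ q = ⊥-elim (u≢z (trans p (sym q)))

    Π-labelled : ∀ {w} → InΠ N a w → w ≡ t ⊎ w ≡ v ⊎ w ≡ u ⊎ w ≡ z
    Π-labelled {w} w∈ with w ≟P t | w ≟P v
    ... | yes w≡t | _ = inj₁ w≡t
    ... | no _ | yes w≡v = inj₂ (inj₁ w≡v)
    ... | no w≢t | no w≢v with crossing w∈ w≢t w≢v | u-z-crossing
    ... | inj₁ refl | inj₁ (u≡ , _) = inj₂ (inj₂ (inj₁ (sym u≡)))
    ... | inj₁ refl | inj₂ (_ , z≡) = inj₂ (inj₂ (inj₂ (sym z≡)))
    ... | inj₂ refl | inj₁ (_ , z≡) = inj₂ (inj₂ (inj₂ (sym z≡)))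
    ... | inj₂ refl | inj₂ (u≡ , _) = inj₂ (inj₂ (inj₁ (sym u≡)))

    -- The edge taken after e when a is split by b: true is ẇ^(a) (keeps u, z), false is ẅ^(a) (keeps t, v).
    next : Bool → Fin n → Fin n
    next false e = if does (e ≟F tx) then ty else vy
    next true e = if does (e ≟F tx) then vy else ty

    next-false-tx : next false tx ≡ ty
    next-false-tx with tx ≟F tx
    ... | yes _ = refl
    ... | no tx≢tx = ⊥-elim (tx≢tx refl)

    next-false-vx : next false vx ≡ vy
    next-false-vx with vx ≟F tx
    ... | yes vx≡tx = ⊥-elim (tx≢vx (sym vx≡tx))
    ... | no _ = refl

    next-true-tx : next true tx ≡ vy
    next-true-tx with tx ≟F tx
    ... | yes _ = refl
    ... | no tx≢tx = ⊥-elim (tx≢tx refl)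

    next-true-vx : next true vx ≡ ty
    next-true-vx with vx ≟F tx
    ... | yes vx≡tx = ⊥-elim (tx≢vx (sym vx≡tx))
    ... | no _ = refl

    next-tx-injective : ∀ {b b′} → next b tx ≡ next b′ tx → b ≡ b′
    next-tx-injective {false} {false} _ = refl
    next-tx-injective {true} {true} _ = refl
    next-tx-injective {false} {true} eq = ⊥-elim (ty≢vy (trans (sym next-false-tx) (trans eq next-true-tx)))
    next-tx-injective {true} {false} eq = ⊥-elim (ty≢vy (trans (sym next-false-tx) (trans (sym eq) next-true-tx)))

    next-separates : ∀ b → next b tx ≢ next b vx
    next-separates false eq = ty≢vy (trans (sym next-false-tx) (trans eq next-false-vx))
    next-separates true eq = ty≢vy (trans (sym next-true-vx) (trans (sym eq) next-true-tx))

    colour : Maybe Bool → Fin n → Fin n → Colour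
    colour nothing e f = blu
    colour (just b) e f = if does (f ≟F next b e) then blk else absent

    colour-next : ∀ b e → colour (just b) e (next b e) ≡ blk
    colour-next b e with next b e ≟F next b e
    ... | yes _ = refl
    ... | no ≢ = ⊥-elim (≢ refl)

    colour-other : ∀ b e f → f ≢ next b e → colour (just b) e f ≡ absent
    colour-other b e f f≢ with f ≟F next b e
    ... | yes f≡ = ⊥-elim (f≢ f≡)
    ... | no _ = refl

    colour-t : ∀ b → colour (just b) tx ty ≡ (if b then absent else blk)
    colour-t false = subst (λ f → colour (just false) tx f ≡ blk) next-false-tx (colour-next false tx)
    colour-t true = colour-other true tx ty λ eq → ty≢vy (trans eq next-true-tx)

    colour-v : ∀ b → colour (just b) vx vy ≡ (if b then absent else blk)
    colour-v false = subst (λ f → colour (just false) vx f ≡ blk) next-false-vx (colour-next false vx)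
    colour-v true = colour-other true vx vy λ eq → ty≢vy (sym (trans eq next-true-vx))

    colour-tv : ∀ b → colour (just b) tx vy ≡ (if b then blk else absent)
    colour-tv false = colour-other false tx vy λ eq → ty≢vy (sym (trans eq next-false-tx))
    colour-tv true = subst (λ f → colour (just true) tx f ≡ blk) next-true-tx (colour-next true tx)

    colour-vt : ∀ b → colour (just b) vx ty ≡ (if b then blk else absent)
    colour-vt false = colour-other false vx ty λ eq → ty≢vy (trans eq next-false-vx)
    colour-vt true = subst (λ f → colour (just true) vx f ≡ blk) next-true-vx (colour-next true vx)

    colour-u : ∀ b → colour (just b) (proj₁ u) (proj₂ u) ≡ (if b then blk else absent)
    colour-u b with u-z-crossing
    ... | inj₁ (u≡ , _) rewrite u≡ = colour-tv b
    ... | inj₂ (u≡ , _) rewrite u≡ = colour-vt b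

    colour-z : ∀ b → colour (just b) (proj₁ z) (proj₂ z) ≡ (if b then blk else absent)
    colour-z b with u-z-crossing
    ... | inj₁ (_ , z≡) rewrite z≡ = colour-vt b
    ... | inj₂ (_ , z≡) rewrite z≡ = colour-tv b

    op-Π : ∀ b c {e f} → tgt e ≡ a → src f ≡ a → op a b c (blue e f) ≡ colour (just b) e f
    op-Π b c {e} {f} te sf with (e , f) ≟P t | (e , f) ≟P v | (e , f) ≟P u | (e , f) ≟P z | Π-labelled (te , sf)
    ... | yes refl | _ | _ | _ | _ = sym (colour-t b)
    ... | no _ | yes refl | _ | _ | _ = sym (colour-v b)
    ... | no _ | no _ | yes refl | _ | _ = sym (colour-u b)
    ... | no _ | no _ | no _ | yes refl | _ = sym (colour-z b)
    ... | no ≢t | _ | _ | _ | inj₁ ≡t = ⊥-elim (≢t ≡t)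
    ... | no _ | no ≢v | _ | _ | inj₂ (inj₁ ≡v) = ⊥-elim (≢v ≡v)
    ... | no _ | no _ | no ≢u | _ | inj₂ (inj₂ (inj₁ ≡u)) = ⊥-elim (≢u ≡u)
    ... | no _ | no _ | no _ | no ≢z | inj₂ (inj₂ (inj₂ ≡z)) = ⊥-elim (≢z ≡z)

    op-outside : ∀ b c {e f} → ¬ InΠ N a (e , f) → op a b c (blue e f) ≡ c (blue e f)
    op-outside b c {e} {f} ∉Π with (e , f) ≟P t | (e , f) ≟P v | (e , f) ≟P u | (e , f) ≟P z
    ... | yes refl | _ | _ | _ = ⊥-elim (∉Π t∈)
    ... | no _ | yes refl | _ | _ = ⊥-elim (∉Π v∈)
    ... | no _ | no _ | yes refl | _ = ⊥-elim (∉Π u∈)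
    ... | no _ | no _ | no _ | yes refl = ⊥-elim (∉Π z∈)
    ... | no _ | no _ | no _ | no _ = refl

    src-next : ∀ b {e} → src (next b e) ≡ a
    src-next false {e} with e ≟F tx
    ... | yes _ = proj₂ t∈
    ... | no _ = proj₂ v∈
    src-next true {e} with e ≟F tx
    ... | yes _ = proj₂ v∈
    ... | no _ = proj₂ t∈

    next-injective : ∀ b {e e′} → tgt e ≡ a → tgt e′ ≡ a → next b e ≡ next b e′ → e ≡ e′
    next-injective b te te′ eq with in-edge te | in-edge te′
    ... | inj₁ refl | inj₁ refl = refl
    ... | inj₂ refl | inj₂ refl = refl
    ... | inj₁ refl | inj₂ refl = ⊥-elim (next-separates b eq)
    ... | inj₂ refl | inj₁ refl = ⊥-elim (next-separates b (sym eq))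

  -- nothing iff a is still unsplit in the member bs of W_i.
  decided : (i : ℕ) → i ≤ m → Vec Bool i → Fin m → Maybe Bool
  decided zero _ [] a = nothing
  decided (suc i) p (b ∷ bs) a = if does (a ≟F φ' (fromℕ< p)) then just b else decided i (<⇒≤ p) bs a

  Wc-black : ∀ i p bs e → Wc i p bs (black e) ≡ blk
  Wc-black zero p [] e = refl
  Wc-black (suc i) p (b ∷ bs) e = Wc-black i (<⇒≤ p) bs e

  Wc-unlinked : ∀ i p bs {e f} → tgt e ≢ src f → Wc i p bs (blue e f) ≡ absent
  Wc-unlinked zero p [] {e} {f} unlinked with tgt e ≟F src f
  ... | yes linked = ⊥-elim (unlinked linked)
  ... | no _ = refl
  Wc-unlinked (suc i) p (b ∷ bs) unlinked =
    trans (Node.op-outside _ b (Wc i (<⇒≤ p) bs) λ (te , sf) → unlinked (trans te (sym sf))) (Wc-unlinked i (<⇒≤ p) bs unlinked)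

  Wc-linked : ∀ i p bs {e f} → tgt e ≡ src f → Wc i p bs (blue e f) ≡ Node.colour (tgt e) (decided i p bs (tgt e)) e f
  Wc-linked zero p [] {e} {f} linked with tgt e ≟F src f
  ... | yes _ = refl
  ... | no unlinked = ⊥-elim (unlinked linked)
  Wc-linked (suc i) p (b ∷ bs) {e} {f} linked with tgt e ≟F φ' (fromℕ< p)
  ... | yes te≡ = trans (Node.op-Π _ b (Wc i (<⇒≤ p) bs) te≡ (trans (sym linked) te≡)) (cong (λ a → Node.colour a (just b) e f) (sym te≡))
  ... | no te≢ = trans (Node.op-outside _ b (Wc i (<⇒≤ p) bs) (te≢ ∘ proj₁)) (Wc-linked i (<⇒≤ p) bs linked)

  φ⁻¹ : Fin m → Fin m
  φ⁻¹ a = proj₁ (Bijection.surjective φ a)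

  φ-φ⁻¹ : ∀ a → φ' (φ⁻¹ a) ≡ a
  φ-φ⁻¹ a = proj₂ (Bijection.surjective φ a) refl

  split-at : ∀ {i} (p : suc i ≤ m) {a} → a ≡ φ' (fromℕ< p) → toℕ (φ⁻¹ a) ≡ i
  split-at p a≡ = trans (cong toℕ (Bijection.injective φ (trans (φ-φ⁻¹ _) a≡))) (toℕ-fromℕ< p)

  split-at⁻¹ : ∀ {i} (p : suc i ≤ m) {a} → toℕ (φ⁻¹ a) ≡ i → a ≡ φ' (fromℕ< p)
  split-at⁻¹ p {a} pos≡i = trans (sym (φ-φ⁻¹ a)) (cong φ' (toℕ-injective (trans pos≡i (sym (toℕ-fromℕ< p)))))

  decided-later : ∀ i p bs a → i ≤ toℕ (φ⁻¹ a) → decided i p bs a ≡ nothing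
  decided-later zero p [] a _ = refl
  decided-later (suc i) p (b ∷ bs) a i<pos with a ≟F φ' (fromℕ< p)
  ... | yes a≡ = ⊥-elim (<-irrefl (sym (split-at p a≡)) i<pos)
  ... | no _ = decided-later i (<⇒≤ p) bs a (<⇒≤ i<pos)

  decided-earlier : ∀ i p bs a → toℕ (φ⁻¹ a) < i → ∃ λ b → decided i p bs a ≡ just b
  decided-earlier (suc i) p (b ∷ bs) a pos<1+i with a ≟F φ' (fromℕ< p)
  ... | yes _ = b , refl
  ... | no a≢ with m≤n⇒m<n∨m≡n (s≤s⁻¹ pos<1+i)
  ...   | inj₁ pos<i = decided-earlier i (<⇒≤ p) bs a pos<i
  ...   | inj₂ pos≡i = ⊥-elim (a≢ (split-at⁻¹ p pos≡i))

  choice : Vec Bool m → Fin m → Bool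
  choice bs a = proj₁ (decided-earlier m ≤-refl bs a (toℕ<n (φ⁻¹ a)))

  decided-choice : ∀ bs a → decided m ≤-refl bs a ≡ just (choice bs a)
  decided-choice bs a = proj₂ (decided-earlier m ≤-refl bs a (toℕ<n (φ⁻¹ a)))

  successor : (Fin m → Bool) → Fin n → Fin n
  successor ch e = Node.next (tgt e) (ch (tgt e)) e

  src-successor : ∀ ch e → src (successor ch e) ≡ tgt e
  src-successor ch e = Node.src-next (tgt e) (ch (tgt e))

  successor-injective : ∀ ch {e e′} → successor ch e ≡ successor ch e′ → e ≡ e′
  successor-injective ch {e} {e′} eq = Node.next-injective (tgt e) (ch (tgt e)) refl te′
    (trans eq (cong (λ a → Node.next a (ch a) e′) te′))
    where
      te′ : tgt e′ ≡ tgt e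
      te′ = trans (sym (src-successor ch e′)) (trans (sym (cong src eq)) (src-successor ch e))

  successor-cong : ∀ {ch ch′} → (∀ a → ch a ≡ ch′ a) → ∀ e → successor ch e ≡ successor ch′ e
  successor-cong ch≗ch′ e = cong (λ b → Node.next (tgt e) b e) (ch≗ch′ (tgt e))

  -- Members of W_m

  e₀ : Fin n
  e₀ = Data.Fin.zero

  b₀ : QEdge m
  b₀ = black e₀

  module FullyDecided (ch : Fin m → Bool) (c : Colouring m)
                      (c-black : ∀ e → c (black e) ≡ blk)
                      (c-blue : ∀ e f → c (blue e f) ≡ (if does (f ≟F successor ch e) then blk else absent)) where

    s : Fin n → Fin n
    s = successor ch

    -- σ q is the only present edge that can follow q.
    σ : QEdge m → QEdge m
    σ (black e) = blue e (s e)
    σ (blue e f) = black f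

    out : QVertex m → QEdge m
    out (e , minus) = black e
    out (e , plus) = blue e (s e)

    σ-linked : ∀ q → qsrc (σ q) ≡ qtgt q
    σ-linked (black e) = refl
    σ-linked (blue e f) = refl

    σ-out : ∀ q → σ q ≡ out (qtgt q)
    σ-out (black e) = refl
    σ-out (blue e f) = refl

    present-blue : ∀ {e f} → Present c (blue e f) → f ≡ s e
    present-blue {e} {f} present with f ≟F s e | c-blue e f
    ... | yes f≡ | _ = f≡
    ... | no _ | c≡ = ⊥-elim (present c≡)

    present⇒blk : ∀ {q} → Present c q → c q ≡ blk
    present⇒blk {black e} _ = c-black e
    present⇒blk {blue e f} present with f ≟F s e | c-blue e f
    ... | yes _ | c≡ = c≡
    ... | no _ | c≡ = ⊥-elim (present c≡)

    σ-present : ∀ q → Present c (σ q)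
    σ-present (black e) absent≡ with s e ≟F s e | c-blue e (s e)
    ... | yes _ | c≡ with trans (sym c≡) absent≡
    ...   | ()
    σ-present (black e) _ | no ≢ | _ = ≢ refl
    σ-present (blue e f) absent≡ with trans (sym (c-black f)) absent≡
    ... | ()

    black-present : ∀ e → Present c (black e)
    black-present e absent≡ with trans (sym (c-black e)) absent≡
    ... | ()

    forced : ∀ {q} → Present c q → q ≡ out (qsrc q)
    forced {black e} _ = refl
    forced {blue e f} present = cong (blue e) (present-blue present)

    σ-double : ∀ j e → iterate σ (black e) (double j) ≡ black (iterate s e j)
    σ-double zero e = refl
    σ-double (suc j) e = σ-double j (s e)

    σ-odd : ∀ j e → iterate σ (black e) (suc (double j)) ≡ blue (iterate s e j) (s (iterate s e j))
    σ-odd j e = trans (Orbits.iterate-suc _≟Q_ σ (black e) (double j)) (cong σ (σ-double j e))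

    σ-period : ∀ {d} → Orbits.MinimalPeriod _≟F_ s e₀ d → Orbits.MinimalPeriod _≟Q_ σ b₀ (double d)
    σ-period {d} period = record { 1≤d = 1≤D ; returns = trans (σ-double d e₀) (cong black returns) ; minimal = minimal′ }
      where
        open Orbits.MinimalPeriod period
        1≤D : 1 ≤ double d
        1≤D with 1≤d
        ... | s≤s _ = s≤s z≤n
        minimal′ : ∀ {i} → 1 ≤ i → i < double d → iterate σ b₀ i ≢ b₀
        minimal′ {i} 1≤i i<D back with even-or-odd i
        ... | zero , inj₁ refl = case 1≤i of λ ()
        ... | suc j , inj₁ refl = minimal (s≤s z≤n) (double-cancel-< i<D) (black-injective (trans (sym (σ-double (suc j) e₀)) back))
          where
            black-injective : ∀ {e e′} → black {m} e ≡ black e′ → e ≡ e′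
            black-injective refl = refl
        ... | j , inj₂ refl with trans (sym (σ-odd j e₀)) back
        ...   | ()

    module Cycle {d} (period : Orbits.MinimalPeriod _≟F_ s e₀ d) where
      open Orbits.MinimalPeriod period
      open Counting (_≟Q_ {m})
      open Orbits _≟F_ s using () renaming (orbit to s-orbit; ∈-orbit⁻ to ∈-s-orbit⁻; ∈-orbit⁺ to ∈-s-orbit⁺; iterate-suc to s-iterate-suc)
      open Orbits _≟Q_ σ using (orbit; ∈-orbit⁻; ∈-orbit⁺; closed⇒orbit; orbit-+)

      D : ℕ
      D = double d

      σ-period′ : Orbits.MinimalPeriod _≟Q_ σ b₀ D
      σ-period′ = σ-period period

      Spanning : Set
      Spanning = ∀ e → e ∈ s-orbit e₀ d

      s-orbit-closed : ∀ {e} → e ∈ s-orbit e₀ d → s e ∈ s-orbit e₀ d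
      s-orbit-closed e∈ with ∈-s-orbit⁻ e∈
      ... | i , i<d , refl with m≤n⇒m<n∨m≡n i<d
      ...   | inj₁ 1+i<d = subst (_∈ s-orbit e₀ d) (s-iterate-suc e₀ i) (∈-s-orbit⁺ e₀ 1+i<d)
      ...   | inj₂ refl = subst (_∈ s-orbit e₀ d) (trans (sym returns) (s-iterate-suc e₀ i)) (∈-s-orbit⁺ e₀ 1≤d)

      s-orbit-closed⁻ : ∀ {e} → s e ∈ s-orbit e₀ d → e ∈ s-orbit e₀ d
      s-orbit-closed⁻ {e} se∈ with ∈-s-orbit⁻ se∈
      ... | suc i , 1+i<d , se≡ =
        subst (_∈ s-orbit e₀ d) (successor-injective ch (trans (sym (s-iterate-suc e₀ i)) se≡)) (∈-s-orbit⁺ e₀ (<-trans (n<1+n i) 1+i<d))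
      ... | zero , _ , e₀≡se =
        subst (_∈ s-orbit e₀ d) (successor-injective ch (trans (sym (s-iterate-suc e₀ (pred d))) (trans last e₀≡se))) (∈-s-orbit⁺ e₀ pred-d<d)
        where
          pred-d<d : pred d < d
          pred-d<d = ≤-reflexive (suc-pred d {{>-nonZero 1≤d}})
          last : iterate s e₀ (suc (pred d)) ≡ e₀
          last = trans (cong (iterate s e₀) (suc-pred d {{>-nonZero 1≤d}})) returns

      connected⇒spanning : Connected c → Spanning
      connected⇒spanning connected e = along (connected (e₀ , minus) (e , minus)) (∈-s-orbit⁺ e₀ 1≤d)
        where
          step : ∀ {x y} → Adj c x y → proj₁ x ∈ s-orbit e₀ d → proj₁ y ∈ s-orbit e₀ d
          step (black _ , _ , inj₁ (refl , refl)) = id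
          step (black _ , _ , inj₂ (refl , refl)) = id
          step (blue _ _ , present , inj₁ (refl , refl)) rewrite present-blue present = s-orbit-closed
          step (blue _ _ , present , inj₂ (refl , refl)) rewrite present-blue present = s-orbit-closed⁻
          along : ∀ {x y} → Star (Adj c) x y → proj₁ x ∈ s-orbit e₀ d → proj₁ y ∈ s-orbit e₀ d
          along ε = id
          along (adj ◅ path) = along path ∘ step adj

      σ-orbit : List (QEdge m)
      σ-orbit = orbit b₀ D

      σ-orbit-closed : ClosedWalk qsrc qtgt σ-orbit
      σ-orbit-closed = Walks.orbit-closed qsrc qtgt σ σ-linked b₀ D (Orbits.MinimalPeriod.1≤d σ-period′) (Orbits.MinimalPeriod.returns σ-period′)

      σ-orbit-present : ∀ {q} → q ∈ σ-orbit → Present c q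
      σ-orbit-present q∈ with ∈-orbit⁻ q∈
      ... | zero , _ , refl = black-present e₀
      ... | suc i , _ , refl = subst (Present c) (sym (Orbits.iterate-suc _≟Q_ σ b₀ i)) (σ-present _)

      spanning⇒∈σ-orbit : Spanning → ∀ {q} → Present c q → q ∈ σ-orbit
      spanning⇒∈σ-orbit spanning {black e} _ with ∈-s-orbit⁻ (spanning e)
      ... | i , i<d , refl = subst (_∈ σ-orbit) (σ-double i e₀) (∈-orbit⁺ b₀ (<-trans (n<1+n (double i)) (double-mono-< i<d)))
      spanning⇒∈σ-orbit spanning {blue e f} present with present-blue present
      ... | refl with ∈-s-orbit⁻ (spanning e)
      ...   | i , i<d , refl = subst (_∈ σ-orbit) (σ-odd i e₀) (∈-orbit⁺ b₀ (double-mono-< i<d))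

      doubled : List (QEdge m)
      doubled = σ-orbit ++ σ-orbit

      doubled-orbit : doubled ≡ orbit b₀ (D + D)
      doubled-orbit = sym (trans (orbit-+ b₀ D D) (cong (λ q → σ-orbit ++ orbit q D) (Orbits.MinimalPeriod.returns σ-period′)))

      EulerianHere : List (QEdge m) → Set
      EulerianHere = IsEulerian _≟Q_ qsrc qtgt (mult ∘ c)

      doubled-eulerian : Spanning → EulerianHere doubled
      doubled-eulerian spanning = closed , counts
        where
          open Orbits.MinimalPeriod σ-period′ renaming (1≤d to 1≤D; returns to σ-returns)
          closed : ClosedWalk qsrc qtgt doubled
          closed = subst (ClosedWalk qsrc qtgt) (sym doubled-orbit)
            (Walks.orbit-closed qsrc qtgt σ σ-linked b₀ (D + D) (≤-trans 1≤D (m≤m+n D D))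
              (trans (Orbits.iterate-+ _≟Q_ σ b₀ D D) (trans (cong (λ q → iterate σ q D) σ-returns) σ-returns)))
          counts : ∀ q → cnt q doubled ≡ mult (c q)
          counts q with c q in c≡
          ... | absent = trans (cnt-++ q σ-orbit σ-orbit) (cong₂ _+_ none none)
            where
              none : cnt q σ-orbit ≡ 0
              none with cnt q σ-orbit in cnt≡
              ... | zero = refl
              ... | suc _ = ⊥-elim (σ-orbit-present (1≤cnt⇒∈ (subst (1 ≤_) (sym cnt≡) (s≤s z≤n))) c≡)
          ... | blk = trans (cnt-++ q σ-orbit σ-orbit) (cong₂ _+_ once once)
            where
              once : cnt q σ-orbit ≡ 1
              once = Orbits.cnt-orbit _≟Q_ σ σ-period′ (spanning⇒∈σ-orbit spanning λ absent≡ → case trans (sym c≡) absent≡ of λ ())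
          ... | blu with trans (sym (present⇒blk {q} λ absent≡ → case trans (sym c≡) absent≡ of λ ())) c≡
          ...   | ()

      spanning⇒connected : Spanning → Connected c
      spanning⇒connected spanning = closed-walk⇒connected c doubled (proj₁ (doubled-eulerian spanning))
        (All.tabulate λ q∈ → σ-orbit-present (case ∈-++⁻ σ-orbit q∈ of λ { (inj₁ q∈₁) → q∈₁ ; (inj₂ q∈₂) → q∈₂ }))
        (λ e → ∈-++⁺ˡ (spanning⇒∈σ-orbit spanning (black-present e)))

      returning-twice⇒doubled : ∀ {ℓ} → iterate σ b₀ ℓ ≡ b₀ → cnt b₀ (orbit b₀ ℓ) ≡ 2 → orbit b₀ ℓ ≡ doubled
      returning-twice⇒doubled {ℓ} back twice with Orbits.period-divides _≟Q_ σ σ-period′ {ℓ} back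
      ... | q , refl = begin
        orbit b₀ (q * D)       ≡⟨ cong (λ q → orbit b₀ (q * D)) q≡2 ⟩
        orbit b₀ (2 * D)       ≡⟨ cong (λ k → orbit b₀ (D + k)) (+-identityʳ D) ⟩
        orbit b₀ (D + D)       ≡⟨ doubled-orbit ⟨
        doubled                ∎
        where
          open ≡-Reasoning
          q≡2 : q ≡ 2
          q≡2 = trans (sym (Orbits.cnt-orbit-* _≟Q_ σ σ-period′ q)) twice

      eulerian-follows-σ : ∀ {x xs} → EulerianHere (x ∷ xs) → ∀ {e f} → Adjacent e f (x ∷ xs ∷ʳ x) → f ≡ σ e
      eulerian-follows-σ {x} {xs} eul {e} {f} adj = begin
        f                ≡⟨ forced (eulerian-present c eul f∈) ⟩
        out (qsrc f)     ≡⟨ cong out (Walks.closed⇒adjacent-linked qsrc qtgt x xs (proj₁ eul) adj) ⟨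
        out (qtgt e)     ≡⟨ σ-out e ⟨
        σ e              ∎
        where
          open ≡-Reasoning
          f∈ : f ∈ x ∷ xs
          f∈ with ∈-++⁻ xs (adjacent-snd∈ adj)
          ... | inj₁ f∈xs = there f∈xs
          ... | inj₂ (here refl) = here refl

      eulerian-rotation-of-doubled : ∀ {ws} → EulerianHere ws → ∃₂ λ xs ys → ws ≡ xs ++ b₀ ∷ ys × b₀ ∷ ys ++ xs ≡ doubled
      eulerian-rotation-of-doubled {ws} eul with first-occurrence {b₀} {ws} (cnt≡2⇒∈ (trans (proj₂ eul b₀) (cong mult (c-black e₀))))
      ... | xs , ys , refl , _ = xs , ys , refl , trans (proj₁ as-orbit) (returning-twice⇒doubled (proj₂ as-orbit) twice)
        where
          eul′ : EulerianHere (b₀ ∷ ys ++ xs)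
          eul′ = Eulerian.eulerian-++-comm _≟Q_ qsrc qtgt xs (b₀ ∷ ys) eul
          as-orbit : b₀ ∷ ys ++ xs ≡ orbit b₀ (suc (length (ys ++ xs))) × iterate σ b₀ (suc (length (ys ++ xs))) ≡ b₀
          as-orbit = closed⇒orbit b₀ (ys ++ xs) (adjacent⇒closed σ b₀ (ys ++ xs) (eulerian-follows-σ eul′))
          twice : cnt b₀ (orbit b₀ (suc (length (ys ++ xs)))) ≡ 2
          twice = trans (cong (cnt b₀) (sym (proj₁ as-orbit))) (trans (proj₂ eul′ b₀) (cong mult (c-black e₀)))

  Wm : Vec Bool m → Colouring m
  Wm = Wc m ≤-refl

  Wm-blue : ∀ bs e f → Wm bs (blue e f) ≡ (if does (f ≟F successor (choice bs) e) then blk else absent)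
  Wm-blue bs e f with tgt e ≟F src f
  ... | yes linked = trans (Wc-linked m ≤-refl bs linked) (cong (λ d → Node.colour (tgt e) d e f) (decided-choice bs (tgt e)))
  ... | no unlinked with f ≟F successor (choice bs) e
  ...   | yes refl = ⊥-elim (unlinked (sym (src-successor (choice bs) e)))
  ...   | no _ = Wc-unlinked m ≤-refl bs unlinked

  module MemberOfWm (bs : Vec Bool m) where
    open FullyDecided (choice bs) (Wm bs) (Wc-black m ≤-refl bs) (Wm-blue bs) public

    opaque
      s-period : ∃ (Orbits.MinimalPeriod _≟F_ s e₀)
      s-period = injection-periodic s (successor-injective (choice bs)) e₀

    open Cycle (proj₂ s-period) public

  ConnectedMember : Set
  ConnectedMember = Σ (Vec Bool m) (Connected ∘ Wm)

  -- Connectivity proofs are not unique, so connected members are compared by their choice vectors.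
  Classes : Setoid 0ℓ 0ℓ
  Classes = On.setoid {B = ConnectedMember} (≡.setoid (Vec Bool m)) proj₁

  module FamilyRotations {I : Set} (Q : I → Set) (req : I → QEdge m → ℕ) = Rotations
    (ΘFam _≟Q_ qsrc qtgt I Q req) (λ i ws → Q i × IsEulerian _≟Q_ qsrc qtgt (req i) ws)
    (λ i ws (h , p) → i , h , ws , p) (λ (h , p) → h , Eulerian.eulerian-rotate _≟Q_ qsrc qtgt _ _ p)
    (λ _ _ → fwd (refl , _ , _ , refl , refl) ◅ ε)

  Wm-family-classification : (Q : Vec Bool m → Set) →
    (∀ {bs ws} → Q bs → IsEulerian _≟Q_ qsrc qtgt (mult ∘ Wm bs) ws → Connected (Wm bs)) →
    (∀ {bs} → Connected (Wm bs) → Q bs) →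
    Classification (ΘFam _≟Q_ qsrc qtgt (Vec Bool m) Q (λ bs → mult ∘ Wm bs)) Classes
  Wm-family-classification Q connected Q-of = record
    { class = λ (bs , h , ws , p) → bs , connected {bs} {ws} h p
    ; class-cong = ΘFam-index
    ; class-injective = λ { {bs , h , ws , p} {.bs , h′ , ws′ , p′} refl → same-member bs h h′ ws ws′ p p′ }
    ; representative = λ (bs , cn) → bs , Q-of cn , MemberOfWm.doubled bs , MemberOfWm.doubled-eulerian bs (MemberOfWm.connected⇒spanning bs cn)
    ; class-representative = λ _ → refl
    }
    where
      open FamilyRotations Q (λ bs → mult ∘ Wm bs)
      to-doubled : ∀ bs {ws} → IsEulerian _≟Q_ qsrc qtgt (mult ∘ Wm bs) ws → RotationEquivalent bs ws (MemberOfWm.doubled bs)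
      to-doubled bs eul with MemberOfWm.eulerian-rotation-of-doubled bs eul
      ... | xs , ys , ws≡ , rotated≡ = ≈-resp-≡ (sym ws≡) rotated≡ (rotate-to-≈ xs b₀ ys)
      same-member : ∀ bs h h′ ws ws′ p p′ → Setoid._≈_ (ΘFam _≟Q_ qsrc qtgt (Vec Bool m) Q (λ bs → mult ∘ Wm bs)) (bs , h , ws , p) (bs , h′ , ws′ , p′)
      same-member bs h h′ ws ws′ p p′ =
        RotationEquivalent-trans (h , MemberOfWm.doubled-eulerian bs (MemberOfWm.connected⇒spanning bs (connected {bs} {ws} h p)))
          (to-doubled bs {ws} p) (RotationEquivalent-sym (to-doubled bs {ws′} p′)) (h , p) (h′ , p′)

  choice-vector : (i : ℕ) → i ≤ m → (Fin m → Bool) → Vec Bool i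
  choice-vector zero _ ch = []
  choice-vector (suc i) p ch = ch (φ' (fromℕ< p)) ∷ choice-vector i (<⇒≤ p) ch

  choice-vector-cong : ∀ i p {ch ch′} → (∀ a → ch a ≡ ch′ a) → choice-vector i p ch ≡ choice-vector i p ch′
  choice-vector-cong zero p _ = refl
  choice-vector-cong (suc i) p ch≗ch′ = cong₂ _∷_ (ch≗ch′ _) (choice-vector-cong i (<⇒≤ p) ch≗ch′)

  private
    not-split-yet : ∀ {i} (p : suc i ≤ m) a → toℕ (φ⁻¹ a) < i → a ≢ φ' (fromℕ< p)
    not-split-yet p a pos<i a≡ = <-irrefl (split-at p a≡) pos<i

  decided-choice-vector : ∀ i p ch a → toℕ (φ⁻¹ a) < i → decided i p (choice-vector i p ch) a ≡ just (ch a)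
  decided-choice-vector (suc i) p ch a pos<1+i with a ≟F φ' (fromℕ< p)
  ... | yes a≡ = cong (just ∘ ch) (sym a≡)
  ... | no a≢ with m≤n⇒m<n∨m≡n (s≤s⁻¹ pos<1+i)
  ...   | inj₁ pos<i = decided-choice-vector i (<⇒≤ p) ch a pos<i
  ...   | inj₂ pos≡i = ⊥-elim (a≢ (split-at⁻¹ p pos≡i))

  choice-vector-unique : ∀ i p bs ch → (∀ a → toℕ (φ⁻¹ a) < i → decided i p bs a ≡ just (ch a)) → choice-vector i p ch ≡ bs
  choice-vector-unique zero p [] ch _ = refl
  choice-vector-unique (suc i) p (b ∷ bs) ch agrees = cong₂ _∷_ head-agrees (choice-vector-unique i (<⇒≤ p) bs ch tail-agrees)
    where
      a₀ : Fin m
      a₀ = φ' (fromℕ< p)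
      head-agrees : ch a₀ ≡ b
      head-agrees with a₀ ≟F a₀ | agrees a₀ (≤-reflexive (cong suc (split-at p refl)))
      ... | yes _ | just≡ = sym (Maybe.just-injective just≡)
      ... | no a₀≢a₀ | _ = ⊥-elim (a₀≢a₀ refl)
      tail-agrees : ∀ a → toℕ (φ⁻¹ a) < i → decided i (<⇒≤ p) bs a ≡ just (ch a)
      tail-agrees a pos<i with a ≟F a₀ | agrees a (m≤n⇒m≤1+n pos<i)
      ... | yes a≡ | _ = ⊥-elim (not-split-yet p a pos<i a≡)
      ... | no _ | just≡ = just≡

  choice-choice-vector : ∀ ch a → choice (choice-vector m ≤-refl ch) a ≡ ch a
  choice-choice-vector ch a = Maybe.just-injective
    (trans (sym (decided-choice (choice-vector m ≤-refl ch) a)) (decided-choice-vector m ≤-refl ch a (toℕ<n (φ⁻¹ a))))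

  choice-vector-choice : ∀ bs → choice-vector m ≤-refl (choice bs) ≡ bs
  choice-vector-choice bs = choice-vector-unique m ≤-refl bs (choice bs) (λ a _ → decided-choice bs a)

  -- Eulerian cycles of N

  EulerianN : List (Fin n) → Set
  EulerianN = IsEulerian _≟F_ src tgt (λ _ → 1)

  open CanonicalRotation (_≟F_ {n}) using (rotate-to; rotate-to-first-occurrence; rotate-to-rotate)

  -- A cycle of N read from e₀, with e₀ repeated at the end so that its closing step is an adjacency.
  from-e₀ : List (Fin n) → List (Fin n)
  from-e₀ ws = rotate-to e₀ ws ∷ʳ e₀

  -- The split of a cycle at a: false iff it passes through t_a, i.e. takes t_x directly to t_y.
  cycle-choice : List (Fin n) → Fin m → Bool
  cycle-choice ws a = not (does (adjacent? (_≟F_ {n}) (Node.tx a) (Node.ty a) (from-e₀ ws)))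

  module CycleOfN (ws : List (Fin n)) (eul : EulerianN ws) where
    open Counting (_≟F_ {n})
    open Orbits _≟F_ (successor (cycle-choice ws)) using (orbit; closed⇒orbit; MinimalPeriod; orbit-minimal-period)

    private
      split : ∃₂ λ xs ys → ws ≡ xs ++ e₀ ∷ ys × cnt e₀ xs ≡ 0
      split = first-occurrence {e₀} {ws} (cnt≡1⇒∈ (proj₂ eul e₀))
      xs ys : List (Fin n)
      xs = proj₁ split
      ys = proj₁ (proj₂ split)

    rest : List (Fin n)
    rest = ys ++ xs

    ws≡ : ws ≡ xs ++ e₀ ∷ ys
    ws≡ = proj₁ (proj₂ (proj₂ split))

    from-e₀≡ : from-e₀ ws ≡ e₀ ∷ rest ∷ʳ e₀
    from-e₀≡ = cong (_∷ʳ e₀) (trans (cong (rotate-to e₀) ws≡) (rotate-to-first-occurrence e₀ xs ys (proj₂ (proj₂ (proj₂ split)))))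

    eulerian-from-e₀ : EulerianN (e₀ ∷ rest)
    eulerian-from-e₀ = Eulerian.eulerian-++-comm (_≟F_ {n}) src tgt xs (e₀ ∷ ys) (subst EulerianN ws≡ eul)

    once : ∀ e → cnt e (e₀ ∷ rest) ≡ 1
    once = proj₂ eulerian-from-e₀

    M : List (Fin n)
    M = e₀ ∷ rest ∷ʳ e₀

    adjacent-linked : ∀ {e f} → Adjacent e f M → src f ≡ tgt e
    adjacent-linked adj = sym (Walks.closed⇒adjacent-linked src tgt e₀ rest (proj₁ eulerian-from-e₀) adj)

    unique-successor : ∀ {e f f′} → Adjacent e f M → Adjacent e f′ M → f ≡ f′
    unique-successor {e} adj adj′ = adjacent-functional (_≟F_ {n}) {xs = e₀ ∷ rest} e₀ adj adj′ (once e)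

    unique-predecessor : ∀ {e e′ f} → Adjacent e f M → Adjacent e′ f M → e ≡ e′
    unique-predecessor {f = f} adj adj′ = adjacent-injective (_≟F_ {n}) adj adj′ (trans (cnt-∷ʳ f rest e₀) (once f))

    has-successor : ∀ e → ∃ λ f → Adjacent e f M
    has-successor e = adjacent-∃ {xs = e₀ ∷ rest} e₀ (cnt≡1⇒∈ (once e))

    ch : Fin m → Bool
    ch = cycle-choice ws

    passes-t : ∀ a → Adjacent (Node.tx a) (Node.ty a) M → ch a ≡ false
    passes-t a adj with adjacent? (_≟F_ {n}) (Node.tx a) (Node.ty a) (from-e₀ ws)
    ... | yes _ = refl
    ... | no ¬adj = ⊥-elim (¬adj (subst (Adjacent _ _) (sym from-e₀≡) adj))

    avoids-t : ∀ a → ¬ Adjacent (Node.tx a) (Node.ty a) M → ch a ≡ true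
    avoids-t a ¬adj with adjacent? (_≟F_ {n}) (Node.tx a) (Node.ty a) (from-e₀ ws)
    ... | yes adj = ⊥-elim (¬adj (subst (Adjacent _ _) from-e₀≡ adj))
    ... | no _ = refl

    follows-at : ∀ a {e f} → tgt e ≡ a → Adjacent e f M → f ≡ Node.next a (ch a) e
    follows-at a {e} {f} te adj = by-cases (in-edge te) (out-edge (trans (adjacent-linked adj) te)) (adjacent? (_≟F_ {n}) tx ty M)
      where
        open Node a
        by-cases : e ≡ tx ⊎ e ≡ vx → f ≡ ty ⊎ f ≡ vy → Dec (Adjacent tx ty M) → f ≡ next (ch a) e
        by-cases e≡ f≡ (yes t-adj) rewrite passes-t a t-adj with e≡ | f≡
        ... | inj₁ refl | inj₁ refl = sym next-false-tx
        ... | inj₁ refl | inj₂ refl = ⊥-elim (ty≢vy (unique-successor t-adj adj))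
        ... | inj₂ refl | inj₁ refl = ⊥-elim (tx≢vx (unique-predecessor t-adj adj))
        ... | inj₂ refl | inj₂ refl = sym next-false-vx
        by-cases e≡ f≡ (no ¬t-adj) rewrite avoids-t a ¬t-adj with e≡ | f≡
        ... | inj₁ refl | inj₁ refl = ⊥-elim (¬t-adj adj)
        ... | inj₁ refl | inj₂ refl = sym next-true-tx
        ... | inj₂ refl | inj₁ refl = sym next-true-vx
        ... | inj₂ refl | inj₂ refl with has-successor tx   -- t_x can be followed neither by t_y nor by v_y
        ...   | g , tx-adj with out-edge (trans (adjacent-linked tx-adj) (proj₁ t∈))
        ...     | inj₁ refl = ⊥-elim (¬t-adj tx-adj)
        ...     | inj₂ refl = ⊥-elim (tx≢vx (unique-predecessor tx-adj adj))

    ℓ : ℕ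
    ℓ = suc (length rest)

    as-orbit : e₀ ∷ rest ≡ orbit e₀ ℓ × iterate (successor ch) e₀ ℓ ≡ e₀
    as-orbit = closed⇒orbit e₀ rest (adjacent⇒closed (successor ch) e₀ rest (follows-at _ refl))

    period : MinimalPeriod e₀ ℓ
    period = orbit-minimal-period (s≤s z≤n) (proj₂ as-orbit) (trans (cong (cnt e₀) (sym (proj₁ as-orbit))) (once e₀))

    spanning : ∀ e → e ∈ orbit e₀ ℓ
    spanning e = subst (e ∈_) (proj₁ as-orbit) (cnt≡1⇒∈ (once e))

  module ΘN-rotations = Rotations ΘN (λ (_ : ⊤) → EulerianN) (λ _ ws p → ws , p)
    (Eulerian.eulerian-rotate _≟F_ src tgt _ _) (λ _ _ → fwd (_ , _ , refl , refl) ◅ ε)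

  cycle-vector : List (Fin n) → Vec Bool m
  cycle-vector ws = choice-vector m ≤-refl (cycle-choice ws)

  module _ (ws : List (Fin n)) (eul : EulerianN ws) where
    private
      module C = CycleOfN ws eul
      module W = MemberOfWm (cycle-vector ws)

    cycle-successor : ∀ e → W.s e ≡ successor C.ch e
    cycle-successor = successor-cong (choice-choice-vector C.ch)

    cycle-period : proj₁ W.s-period ≡ C.ℓ
    cycle-period = Orbits.minimal-period-unique _≟F_ W.s (proj₂ W.s-period) (minimal-period-cong _≟F_ (sym ∘ cycle-successor) C.period)

    cycle-connected : Connected (Wm (cycle-vector ws))
    cycle-connected = W.spanning⇒connected λ e → subst (e ∈_) same-orbit (C.spanning e)
      where
        same-orbit : List.iterate (successor C.ch) e₀ C.ℓ ≡ List.iterate W.s e₀ (proj₁ W.s-period)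
        same-orbit = trans (sym (orbit-cong _≟F_ cycle-successor e₀ C.ℓ)) (cong (List.iterate W.s e₀) (sym cycle-period))

  cycle-vector-rotate : ∀ x xs → EulerianN (x ∷ xs) → cycle-vector (xs ∷ʳ x) ≡ cycle-vector (x ∷ xs)
  cycle-vector-rotate x xs eul = choice-vector-cong m ≤-refl λ a →
    cong (λ l → not (does (adjacent? (_≟F_ {n}) (Node.tx a) (Node.ty a) (l ∷ʳ e₀)))) (rotate-to-rotate e₀ x xs (proj₂ eul e₀))

  cycle-vector-cong : ∀ {x y} → Setoid._≈_ ΘN x y → cycle-vector (proj₁ x) ≡ cycle-vector (proj₁ y)
  cycle-vector-cong ε = refl
  cycle-vector-cong {_ , eul} (fwd (x , xs , refl , refl) ◅ path) = trans (sym (cycle-vector-rotate x xs eul)) (cycle-vector-cong path)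
  cycle-vector-cong (_◅_ {j = _ , eul} (bwd (x , xs , refl , refl)) path) = trans (cycle-vector-rotate x xs eul) (cycle-vector-cong path)

  cycle-vector-injective : ∀ {ws ws′} (eul : EulerianN ws) (eul′ : EulerianN ws′) →
                           cycle-vector ws ≡ cycle-vector ws′ → Setoid._≈_ ΘN (ws , eul) (ws′ , eul′)
  cycle-vector-injective {ws} {ws′} eul eul′ same =
    RotationEquivalent-trans C′.eulerian-from-e₀ (≈-resp-≡ refl same-list (to-e₀ ws eul)) (RotationEquivalent-sym (to-e₀ ws′ eul′)) eul eul′
    where
      open ΘN-rotations
      module C = CycleOfN ws eul
      module C′ = CycleOfN ws′ eul′
      to-e₀ : ∀ ws eul → RotationEquivalent tt ws (e₀ ∷ CycleOfN.rest ws eul)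
      to-e₀ ws eul = ≈-resp-≡ (sym (CycleOfN.ws≡ ws eul)) refl (rotate-to-≈ _ e₀ _)
      same-successor : ∀ e → successor C.ch e ≡ successor C′.ch e
      same-successor = successor-cong λ a →
        trans (sym (choice-choice-vector C.ch a)) (trans (cong (λ v → choice v a) same) (choice-choice-vector C′.ch a))
      same-period : C.ℓ ≡ C′.ℓ
      same-period = Orbits.minimal-period-unique _≟F_ (successor C′.ch) (minimal-period-cong _≟F_ same-successor C.period) C′.period
      same-list : e₀ ∷ C.rest ≡ e₀ ∷ C′.rest
      same-list = begin
        e₀ ∷ C.rest                                 ≡⟨ proj₁ C.as-orbit ⟩
        List.iterate (successor C.ch) e₀ C.ℓ        ≡⟨ orbit-cong _≟F_ same-successor e₀ C.ℓ ⟩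
        List.iterate (successor C′.ch) e₀ C.ℓ       ≡⟨ cong (List.iterate (successor C′.ch) e₀) same-period ⟩
        List.iterate (successor C′.ch) e₀ C′.ℓ      ≡⟨ proj₁ C′.as-orbit ⟨
        e₀ ∷ C′.rest                                ∎
        where open ≡-Reasoning

  module OrbitCycle (bs : Vec Bool m) (connected : Connected (Wm bs)) where
    open MemberOfWm bs using (s; s-period; connected⇒spanning)
    open Orbits _≟F_ s using (orbit; cnt-orbit; orbit-∷ʳ; MinimalPeriod)
    open MinimalPeriod (proj₂ s-period)

    d : ℕ
    d = proj₁ s-period

    cycle : List (Fin n)
    cycle = orbit e₀ d

    eulerian : EulerianN (orbit e₀ d)
    eulerian = Walks.orbit-closed src tgt s (src-successor (choice bs)) e₀ d 1≤d returns ,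
               λ e → cnt-orbit (proj₂ s-period) (connected⇒spanning connected e)

    from-e₀-orbit : from-e₀ (orbit e₀ d) ≡ orbit e₀ (suc d)
    from-e₀-orbit with d | 1≤d | returns
    ... | suc d′ | _ | back = begin
      rotate-to e₀ (orbit e₀ (suc d′)) ∷ʳ e₀        ≡⟨ cong (_∷ʳ e₀) (rotate-to-first-occurrence e₀ [] (orbit (s e₀) d′) refl) ⟩
      (e₀ ∷ orbit (s e₀) d′ ++ []) ∷ʳ e₀            ≡⟨ cong (λ l → (e₀ ∷ l) ∷ʳ e₀) (++-identityʳ _) ⟩
      orbit e₀ (suc d′) ∷ʳ e₀                       ≡⟨ cong (orbit e₀ (suc d′) ∷ʳ_) back ⟨
      orbit e₀ (suc d′) ∷ʳ iterate s e₀ (suc d′)    ≡⟨ orbit-∷ʳ e₀ (suc d′) ⟨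
      orbit e₀ (suc (suc d′))                       ∎
      where open ≡-Reasoning

    cycle-choice-orbit : ∀ a → cycle-choice (orbit e₀ d) a ≡ choice bs a
    cycle-choice-orbit a with CycleOfN.has-successor (orbit e₀ d) eulerian (Node.tx a)
    ... | f , adj = Node.next-tx-injective a (begin
      Node.next a (cycle-choice (orbit e₀ d) a) (Node.tx a) ≡⟨ CycleOfN.follows-at (orbit e₀ d) eulerian a tx-in adj ⟨
      f                                                    ≡⟨ orbit-adjacent s e₀ (suc d) (subst (Adjacent _ _) (trans (sym (CycleOfN.from-e₀≡ (orbit e₀ d) eulerian)) from-e₀-orbit) adj) ⟩
      s (Node.tx a)                                        ≡⟨ cong (λ a′ → Node.next a′ (choice bs a′) (Node.tx a)) tx-in ⟩
      Node.next a (choice bs a) (Node.tx a)                ∎)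
      where
        open ≡-Reasoning
        tx-in : tgt (Node.tx a) ≡ a
        tx-in = proj₁ (Node.t∈ a)

  ΘN-classification : Classification ΘN Classes
  ΘN-classification = record
    { class = λ (ws , eul) → cycle-vector ws , cycle-connected ws eul
    ; class-cong = cycle-vector-cong
    ; class-injective = λ {(_ , eul)} {(_ , eul′)} → cycle-vector-injective eul eul′
    ; representative = λ (bs , connected) → OrbitCycle.cycle bs connected , OrbitCycle.eulerian bs connected
    ; class-representative = λ (bs , connected) →
        trans (choice-vector-cong m ≤-refl (OrbitCycle.cycle-choice-orbit bs connected)) (choice-vector-choice bs)
    }

  Wm-classification : Classification (ΘW m ≤-refl) Classes
  Wm-classification = Wm-family-classification (λ _ → ⊤) (λ {bs} {ws} _ → eulerian⇒connected (Wm bs) (Wc-black m ≤-refl bs) {ws}) (λ _ → tt)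

  Δ-classification : Classification ΘΔ Classes
  Δ-classification = Wm-family-classification (Connected ∘ Wm) (λ connected _ → connected) id

  -- Members of W_{m-1}

  k≤m : k ≤ m
  k≤m = m∸n≤m m 1

  -- The node split last, so the only unsplit node in the members of W_{m-1}.
  a⋆ : Fin m
  a⋆ = φ' (fromℕ< (≤-refl {m}))

  open Node a⋆ using (tx; ty; vx; vy; tx≢vx; ty≢vy; in-edge; out-edge) renaming (t∈ to t∈⋆; v∈ to v∈⋆)

  blue-injectiveˡ : ∀ {e f e′ f′} → blue {m} e f ≡ blue e′ f′ → e ≡ e′
  blue-injectiveˡ refl = refl

  blue-injectiveʳ : ∀ {e f e′ f′} → blue {m} e f ≡ blue e′ f′ → f ≡ f′
  blue-injectiveʳ refl = refl

  -- τtv and τvt are u_a⋆ and z_a⋆ in some order (Node.u-z-crossing).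
  τt τv τtv τvt : QEdge m
  τt = blue tx ty
  τv = blue vx vy
  τtv = blue tx vy
  τvt = blue vx ty

  -- Blue pairs entering a⋆; those present in a colouring are its edges of Π(a⋆).
  IsΠ : QEdge m → Set
  IsΠ (black _) = ⊥
  IsΠ (blue e f) = tgt e ≡ a⋆

  IsΠ? : ∀ q → Dec (IsΠ q)
  IsΠ? (black _) = no λ ()
  IsΠ? (blue e f) = tgt e ≟F a⋆

  Π-τt : IsΠ τt
  Π-τt = proj₁ t∈⋆
  Π-τv : IsΠ τv
  Π-τv = proj₁ v∈⋆
  Π-τtv : IsΠ τtv
  Π-τtv = proj₁ t∈⋆
  Π-τvt : IsΠ τvt
  Π-τvt = proj₁ v∈⋆

  -- The tails of the edges of Π(a⋆); a walk avoiding Π(a⋆) cannot continue from them.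
  Stop : QVertex m → Set
  Stop w = w ≡ (tx , plus) ⊎ w ≡ (vx , plus)

  stop-Π : ∀ {q} → Stop (qsrc q) → IsΠ q
  stop-Π {blue e f} (inj₁ refl) = proj₁ t∈⋆
  stop-Π {blue e f} (inj₂ refl) = proj₁ v∈⋆

  decided-a⋆ : ∀ b bs′ → decided m ≤-refl (b ∷ bs′) a⋆ ≡ just b
  decided-a⋆ b bs′ with a⋆ ≟F a⋆
  ... | yes _ = refl
  ... | no a⋆≢a⋆ = ⊥-elim (a⋆≢a⋆ refl)

  decided-other : ∀ b bs′ {a} → a ≢ a⋆ → decided m ≤-refl (b ∷ bs′) a ≡ decided k k≤m bs′ a
  decided-other b bs′ {a} a≢a⋆ with a ≟F a⋆
  ... | yes a≡a⋆ = ⊥-elim (a≢a⋆ a≡a⋆)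
  ... | no _ = cong (λ p → decided k p bs′ a) (≤-irrelevant _ _)

  undecided-a⋆ : ∀ bs′ → decided k k≤m bs′ a⋆ ≡ nothing
  undecided-a⋆ bs′ = decided-later k k≤m bs′ a⋆ (≤-reflexive (sym (split-at ≤-refl refl)))

  module MemberOfWm-1 (bs′ : Vec Bool k) where
    open Counting (_≟Q_ {m})
    open Walks (qsrc {m}) qtgt

    c′ : Colouring m
    c′ = Wc k k≤m bs′

    split : Bool → Colouring m
    split b = Wm (b ∷ bs′)

    EulerianHere : List (QEdge m) → Set
    EulerianHere = IsEulerian _≟Q_ qsrc qtgt (mult ∘ c′)

    c′-split : ∀ b q → ¬ IsΠ q → c′ q ≡ split b q
    c′-split b (black e) _ = trans (Wc-black k k≤m bs′ e) (sym (Wc-black m ≤-refl (b ∷ bs′) e))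
    c′-split b (blue e f) ∉Π with tgt e ≟F src f
    ... | no unlinked = trans (Wc-unlinked k k≤m bs′ unlinked) (sym (Wc-unlinked m ≤-refl (b ∷ bs′) unlinked))
    ... | yes linked = begin
      c′ (blue e f)                                                 ≡⟨ Wc-linked k k≤m bs′ linked ⟩
      Node.colour (tgt e) (decided k k≤m bs′ (tgt e)) e f           ≡⟨ cong (λ d → Node.colour (tgt e) d e f) (decided-other b bs′ ∉Π) ⟨
      Node.colour (tgt e) (decided m ≤-refl (b ∷ bs′) (tgt e)) e f  ≡⟨ Wc-linked m ≤-refl (b ∷ bs′) linked ⟨
      split b (blue e f)                                            ∎
      where open ≡-Reasoning

    c′-Π : ∀ {e f} → tgt e ≡ a⋆ → src f ≡ a⋆ → c′ (blue e f) ≡ blu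
    c′-Π {e} {f} te sf =
      trans (Wc-linked k k≤m bs′ (trans te (sym sf)))
        (trans (cong (λ a → Node.colour a (decided k k≤m bs′ a) e f) te) (cong (λ d → Node.colour a⋆ d e f) (undecided-a⋆ bs′)))

    Free : QEdge m → Set
    Free q = Present c′ q × ¬ IsΠ q

    Segment : QVertex m → List (QEdge m) → QVertex m → Set
    Segment v S w = Walk v S w × All Free S

    private
      module F = MemberOfWm (false ∷ bs′)

    free-forced : ∀ {q} → Free q → q ≡ F.out (qsrc q)
    free-forced {q} (present , ∉Π) = F.forced λ absent≡ → present (trans (c′-split false q ∉Π) absent≡)

    segments-agree : ∀ {v w w′} S S′ → Segment v S w → Segment v S′ w′ → Stop w → Stop w′ → S ≡ S′ × w ≡ w′
    segments-agree [] [] (refl , _) (refl , _) _ _ = refl , refl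
    segments-agree [] (q′ ∷ _) (refl , _) ((src≡ , _) , (_ , ∉Π) ∷ _) stop _ = ⊥-elim (∉Π (stop-Π (subst Stop (sym src≡) stop)))
    segments-agree (q ∷ _) [] ((src≡ , _) , (_ , ∉Π) ∷ _) (refl , _) _ stop = ⊥-elim (∉Π (stop-Π (subst Stop (sym src≡) stop)))
    segments-agree (q ∷ S) (q′ ∷ S′) ((src≡ , walk) , free ∷ frees) ((src≡′ , walk′) , free′ ∷ frees′) stop stop′
      with trans (free-forced free) (trans (cong F.out (trans src≡ (sym src≡′))) (sym (free-forced free′)))
    ... | refl with segments-agree S S′ (walk , frees) (walk′ , frees′) stop stop′
    ...   | refl , w≡w′ = refl , w≡w′

    first-stop second-stop : Bool → QVertex m
    first-stop true = tx , plus
    first-stop false = vx , plus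
    second-stop true = vx , plus
    second-stop false = tx , plus

    shape : Bool → List (QEdge m) → List (QEdge m) → List (QEdge m)
    shape true S₁ S₂ = τt ∷ S₁ ++ τtv ∷ S₂ ++ τv ∷ S₂ ++ τvt ∷ S₁
    shape false S₁ S₂ = τt ∷ S₁ ++ τvt ∷ S₁ ++ τv ∷ S₂ ++ τtv ∷ S₂

    WellShaped : Bool → List (QEdge m) → List (QEdge m) → Set
    WellShaped b S₁ S₂ = Segment (ty , minus) S₁ (first-stop b) × Segment (vy , minus) S₂ (second-stop b)

    first-stop-injective : ∀ {b b′} → first-stop b ≡ first-stop b′ → b ≡ b′
    first-stop-injective {true} {true} _ = refl
    first-stop-injective {false} {false} _ = refl
    first-stop-injective {true} {false} eq = ⊥-elim (tx≢vx (cong proj₁ eq))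
    first-stop-injective {false} {true} eq = ⊥-elim (tx≢vx (sym (cong proj₁ eq)))

    stops : ∀ b → Stop (first-stop b) × Stop (second-stop b)
    stops true = inj₁ refl , inj₂ refl
    stops false = inj₂ refl , inj₁ refl

    well-shaped-unique : ∀ {b b′ S₁ S₂ S₁′ S₂′} → WellShaped b S₁ S₂ → WellShaped b′ S₁′ S₂′ → b ≡ b′ × S₁ ≡ S₁′ × S₂ ≡ S₂′
    well-shaped-unique {b} {b′} {S₁} {S₂} {S₁′} {S₂′} (seg₁ , seg₂) (seg₁′ , seg₂′)
      with segments-agree S₁ S₁′ seg₁ seg₁′ (proj₁ (stops b)) (proj₁ (stops b′))
    ... | refl , stop≡ with first-stop-injective stop≡
    ...   | refl with segments-agree S₂ S₂′ seg₂ seg₂′ (proj₂ (stops b)) (proj₂ (stops b))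
    ...     | refl , _ = refl , refl , refl

    shape-closed : ∀ b {S₁ S₂} → WellShaped b S₁ S₂ → ClosedWalk qsrc qtgt (shape b S₁ S₂)
    shape-closed true {S₁} {S₂} ((walk₁ , _) , (walk₂ , _)) =
      walk⇒closed (shape true S₁ S₂) (refl , walk-++ S₁ _ walk₁ (refl , walk-++ S₂ _ walk₂ (refl , walk-++ S₂ _ walk₂ (refl , walk₁))))
    shape-closed false {S₁} {S₂} ((walk₁ , _) , (walk₂ , _)) =
      walk⇒closed (shape false S₁ S₂) (refl , walk-++ S₁ _ walk₁ (refl , walk-++ S₁ _ walk₁ (refl , walk-++ S₂ _ walk₂ (refl , walk₂))))

    data PresentΠ : QEdge m → Set where
      is-τt : PresentΠ τt
      is-τv : PresentΠ τv
      is-τtv : PresentΠ τtv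
      is-τvt : PresentΠ τvt

    present-Π : ∀ q → Present c′ q → IsΠ q → PresentΠ q
    present-Π (blue e f) present te with tgt e ≟F src f
    ... | no unlinked = ⊥-elim (present (Wc-unlinked k k≤m bs′ unlinked))
    ... | yes linked with in-edge te | out-edge (trans (sym linked) te)
    ...   | inj₁ refl | inj₁ refl = is-τt
    ...   | inj₁ refl | inj₂ refl = is-τtv
    ...   | inj₂ refl | inj₁ refl = is-τvt
    ...   | inj₂ refl | inj₂ refl = is-τv

    Π-blue : ∀ {q} → PresentΠ q → c′ q ≡ blu
    Π-blue is-τt = c′-Π (proj₁ t∈⋆) (proj₂ t∈⋆)
    Π-blue is-τv = c′-Π (proj₁ v∈⋆) (proj₂ v∈⋆)
    Π-blue is-τtv = c′-Π (proj₁ t∈⋆) (proj₂ v∈⋆)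
    Π-blue is-τvt = c′-Π (proj₁ v∈⋆) (proj₂ t∈⋆)

    data OtherΠ : QEdge m → Set where
      is-τv : OtherΠ τv
      is-τtv : OtherΠ τtv
      is-τvt : OtherΠ τvt

    data Order : QEdge m → QEdge m → QEdge m → Set where
      v-tv-vt : Order τv τtv τvt
      v-vt-tv : Order τv τvt τtv
      tv-v-vt : Order τtv τv τvt
      tv-vt-v : Order τtv τvt τv
      vt-v-tv : Order τvt τv τtv
      vt-tv-v : Order τvt τtv τv

    order : ∀ {τ₁ τ₂ τ₃} → OtherΠ τ₁ → OtherΠ τ₂ → OtherΠ τ₃ → τ₁ ≢ τ₂ → τ₁ ≢ τ₃ → τ₂ ≢ τ₃ → Order τ₁ τ₂ τ₃
    order is-τv is-τv _ ≢₁₂ _ _ = ⊥-elim (≢₁₂ refl)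
    order is-τtv is-τtv _ ≢₁₂ _ _ = ⊥-elim (≢₁₂ refl)
    order is-τvt is-τvt _ ≢₁₂ _ _ = ⊥-elim (≢₁₂ refl)
    order is-τv _ is-τv _ ≢₁₃ _ = ⊥-elim (≢₁₃ refl)
    order is-τtv _ is-τtv _ ≢₁₃ _ = ⊥-elim (≢₁₃ refl)
    order is-τvt _ is-τvt _ ≢₁₃ _ = ⊥-elim (≢₁₃ refl)
    order _ is-τv is-τv _ _ ≢₂₃ = ⊥-elim (≢₂₃ refl)
    order _ is-τtv is-τtv _ _ ≢₂₃ = ⊥-elim (≢₂₃ refl)
    order _ is-τvt is-τvt _ _ ≢₂₃ = ⊥-elim (≢₂₃ refl)
    order is-τv is-τtv is-τvt _ _ _ = v-tv-vt
    order is-τv is-τvt is-τtv _ _ _ = v-vt-tv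
    order is-τtv is-τv is-τvt _ _ _ = tv-v-vt
    order is-τtv is-τvt is-τv _ _ _ = tv-vt-v
    order is-τvt is-τv is-τtv _ _ _ = vt-v-tv
    order is-τvt is-τtv is-τv _ _ _ = vt-tv-v

    Analysis : List (QEdge m) → Set
    Analysis R = ∃ λ b → ∃₂ λ S₁ S₂ → τt ∷ R ≡ shape b S₁ S₂ × WellShaped b S₁ S₂

    module FromτT (R : List (QEdge m)) (eul : EulerianHere (τt ∷ R)) where

      walk : Walk (ty , minus) R (tx , plus)
      walk = proj₂ (closed⇒walk τt R (proj₁ eul))

      present : ∀ {q} → q ∈ R → Present c′ q
      present q∈ = eulerian-present c′ eul (there q∈)

      τt-once : cnt τt R ≡ 0
      τt-once = suc-injective (trans (sym (cnt-here τt R)) (trans (proj₂ eul τt) (cong mult (Π-blue is-τt))))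

      ≢τt : ∀ {q} → q ∈ R → q ≢ τt
      ≢τt q∈ refl = <⇒≢ (∈⇒1≤cnt q∈) (sym τt-once)

      Π-once : ∀ {q} → q ∈ R → IsΠ q → cnt q R ≡ 1
      Π-once {q} q∈ π = begin
        cnt q R            ≡⟨ cnt-there R (≢τt q∈) ⟨
        cnt q (τt ∷ R)     ≡⟨ proj₂ eul q ⟩
        mult (c′ q)        ≡⟨ cong mult (Π-blue (present-Π q (present q∈) π)) ⟩
        1                  ∎
        where open ≡-Reasoning

      contains : ∀ {q} → PresentΠ q → q ≢ τt → q ∈ R
      contains {q} π q≢τt = cnt≡1⇒∈ (trans (sym (cnt-there R q≢τt)) (trans (proj₂ eul q) (cong mult (Π-blue π))))

      other-Π : ∀ {q} → q ∈ R → IsΠ q → OtherΠ q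
      other-Π q∈ π with present-Π _ (present q∈) π
      ... | is-τt = ⊥-elim (≢τt q∈ refl)
      ... | is-τv = is-τv
      ... | is-τtv = is-τtv
      ... | is-τvt = is-τvt

      repeated : ∀ {q} → q ∈ R → IsΠ q → 2 ≤ cnt q R → ⊥
      repeated q∈ π 2≤cnt = <-irrefl (sym (Π-once q∈ π)) 2≤cnt

      τv∈ : τv ∈ R
      τv∈ = contains is-τv λ eq → tx≢vx (sym (blue-injectiveˡ eq))
      τtv∈ : τtv ∈ R
      τtv∈ = contains is-τtv λ eq → ty≢vy (sym (blue-injectiveʳ eq))
      τvt∈ : τvt ∈ R
      τvt∈ = contains is-τvt λ eq → tx≢vx (sym (blue-injectiveˡ eq))

    module FourΠ (S₁ : List (QEdge m)) (τ₂ : QEdge m) (S₂ : List (QEdge m)) (τ₃ : QEdge m) (S₃ : List (QEdge m)) (τ₄ : QEdge m) (S₄ : List (QEdge m))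
                 (eul : EulerianHere (τt ∷ S₁ ++ τ₂ ∷ S₂ ++ τ₃ ∷ S₃ ++ τ₄ ∷ S₄))
                 (∉Π₁ : All (¬_ ∘ IsΠ) S₁) (∉Π₂ : All (¬_ ∘ IsΠ) S₂) (∉Π₃ : All (¬_ ∘ IsΠ) S₃)
                 (π₂ : IsΠ τ₂) (π₃ : IsΠ τ₃) (π₄ : IsΠ τ₄) where
      L₃ L₂ R : List (QEdge m)
      L₃ = S₃ ++ τ₄ ∷ S₄
      L₂ = S₂ ++ τ₃ ∷ L₃
      R = S₁ ++ τ₂ ∷ L₂
      open FromτT R eul

      in-L₂ : ∀ {q} → q ∈ L₂ → q ∈ R
      in-L₂ q∈ = ∈-++⁺ʳ S₁ (there q∈)
      in-L₃ : ∀ {q} → q ∈ L₃ → q ∈ R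
      in-L₃ q∈ = in-L₂ (∈-++⁺ʳ S₂ (there q∈))
      in-S₄ : ∀ {q} → q ∈ S₄ → q ∈ L₃
      in-S₄ q∈ = ∈-++⁺ʳ S₃ (there q∈)
      τ₂∈ : τ₂ ∈ R
      τ₂∈ = ∈-++⁺ʳ S₁ (here refl)
      τ₃∈ : τ₃ ∈ R
      τ₃∈ = in-L₂ (∈-++⁺ʳ S₂ (here refl))
      τ₄∈ : τ₄ ∈ R
      τ₄∈ = in-L₃ (∈-++⁺ʳ S₃ (here refl))

      suffix₂ : ∀ q → cnt q L₂ ≤ cnt q R
      suffix₂ q = ≤-trans (cnt-≤-++ q [ τ₂ ] L₂) (cnt-≤-++ q S₁ (τ₂ ∷ L₂))
      suffix₃ : ∀ q → cnt q L₃ ≤ cnt q R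
      suffix₃ q = ≤-trans (≤-trans (cnt-≤-++ q [ τ₃ ] L₃) (cnt-≤-++ q S₂ (τ₃ ∷ L₃))) (suffix₂ q)

      τ₂∉L₂ : τ₂ ∈ L₂ → ⊥
      τ₂∉L₂ τ₂∈L₂ = repeated τ₂∈ π₂ (∈⇒2≤cnt τ₂ S₁ L₂ τ₂∈L₂)
      τ₃∉L₃ : τ₃ ∈ L₃ → ⊥
      τ₃∉L₃ τ₃∈L₃ = repeated τ₃∈ π₃ (≤-trans (∈⇒2≤cnt τ₃ S₂ L₃ τ₃∈L₃) (suffix₂ τ₃))
      τ₄∉S₄ : τ₄ ∈ S₄ → ⊥
      τ₄∉S₄ τ₄∈S₄ = repeated τ₄∈ π₄ (≤-trans (∈⇒2≤cnt τ₄ S₃ S₄ τ₄∈S₄) (suffix₃ τ₄))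

      τ₂≢τ₃ : τ₂ ≢ τ₃
      τ₂≢τ₃ refl = τ₂∉L₂ (∈-++⁺ʳ S₂ (here refl))
      τ₂≢τ₄ : τ₂ ≢ τ₄
      τ₂≢τ₄ refl = τ₂∉L₂ (∈-++⁺ʳ S₂ (there (∈-++⁺ʳ S₃ (here refl))))
      τ₃≢τ₄ : τ₃ ≢ τ₄
      τ₃≢τ₄ refl = τ₃∉L₃ (∈-++⁺ʳ S₃ (here refl))

      walk₁ : Walk (ty , minus) S₁ (qsrc τ₂) × Walk (qtgt τ₂) L₂ (tx , plus)
      walk₁ = walk-split S₁ τ₂ L₂ walk
      walk₂ : Walk (qtgt τ₂) S₂ (qsrc τ₃) × Walk (qtgt τ₃) L₃ (tx , plus)
      walk₂ = walk-split S₂ τ₃ L₃ (proj₂ walk₁)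
      walk₃ : Walk (qtgt τ₃) S₃ (qsrc τ₄) × Walk (qtgt τ₄) S₄ (tx , plus)
      walk₃ = walk-split S₃ τ₄ S₄ (proj₂ walk₂)

      free : ∀ {S} → (∀ {q} → q ∈ S → q ∈ R) → All (¬_ ∘ IsΠ) S → All Free S
      free S⊆R ∉Π = All.tabulate λ q∈ → present (S⊆R q∈) , All.lookup ∉Π q∈

      seg₁ : Segment (ty , minus) S₁ (qsrc τ₂)
      seg₁ = proj₁ walk₁ , free ∈-++⁺ˡ ∉Π₁
      seg₂ : Segment (qtgt τ₂) S₂ (qsrc τ₃)
      seg₂ = proj₁ walk₂ , free (λ q∈ → in-L₂ (∈-++⁺ˡ q∈)) ∉Π₂
      seg₃ : Segment (qtgt τ₃) S₃ (qsrc τ₄)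
      seg₃ = proj₁ walk₃ , free (λ q∈ → in-L₃ (∈-++⁺ˡ q∈)) ∉Π₃

      seg₄ : (∀ {q} → OtherΠ q → q ≡ τ₂ ⊎ q ≡ τ₃ ⊎ q ≡ τ₄) → Segment (qtgt τ₄) S₄ (tx , plus)
      seg₄ all-used = proj₂ walk₃ , All.tabulate λ q∈ → present (in-L₃ (in-S₄ q∈)) , λ π → used-twice q∈ (all-used (other-Π (in-L₃ (in-S₄ q∈)) π))
        where
          used-twice : ∀ {q} → q ∈ S₄ → q ≡ τ₂ ⊎ q ≡ τ₃ ⊎ q ≡ τ₄ → ⊥
          used-twice q∈ (inj₁ refl) = τ₂∉L₂ (∈-++⁺ʳ S₂ (there (in-S₄ q∈)))
          used-twice q∈ (inj₂ (inj₁ refl)) = τ₃∉L₃ (in-S₄ q∈)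
          used-twice q∈ (inj₂ (inj₂ refl)) = τ₄∉S₄ q∈

      tx⁺≢vx⁺ : (tx , plus) ≢ (vx , plus)
      tx⁺≢vx⁺ eq = tx≢vx (cong proj₁ eq)

      by-order : Order τ₂ τ₃ τ₄ → Analysis R
      by-order v-tv-vt = ⊥-elim (tx⁺≢vx⁺ (proj₂ (segments-agree S₂ S₃ seg₂ seg₃ (inj₁ refl) (inj₂ refl))))
      by-order v-vt-tv = ⊥-elim (tx⁺≢vx⁺ (sym (proj₂ (segments-agree S₁ S₃ seg₁ seg₃ (inj₂ refl) (inj₁ refl)))))
      by-order tv-vt-v = ⊥-elim (tx⁺≢vx⁺ (proj₂ (segments-agree S₁ S₃ seg₁ seg₃ (inj₁ refl) (inj₂ refl))))
      by-order vt-tv-v = ⊥-elim (tx⁺≢vx⁺ (sym (proj₂ (segments-agree S₁ S₂ seg₁ seg₂ (inj₂ refl) (inj₁ refl)))))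
      by-order tv-v-vt with segments-agree S₂ S₃ seg₂ seg₃ (inj₂ refl) (inj₂ refl)
                          | segments-agree S₁ S₄ seg₁ (seg₄ λ { is-τv → inj₂ (inj₁ refl) ; is-τtv → inj₁ refl ; is-τvt → inj₂ (inj₂ refl) }) (inj₁ refl) (inj₁ refl)
      ... | refl , _ | refl , _ = true , S₁ , S₂ , refl , seg₁ , seg₂
      by-order vt-v-tv with segments-agree S₁ S₂ seg₁ seg₂ (inj₂ refl) (inj₂ refl)
                          | segments-agree S₃ S₄ seg₃ (seg₄ λ { is-τv → inj₂ (inj₁ refl) ; is-τtv → inj₂ (inj₂ refl) ; is-τvt → inj₁ refl }) (inj₁ refl) (inj₁ refl)
      ... | refl , _ | refl , _ = false , S₁ , S₃ , refl , seg₁ , seg₃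

      analysis : Analysis R
      analysis = by-order (order (other-Π τ₂∈ π₂) (other-Π τ₃∈ π₃) (other-Π τ₄∈ π₄) τ₂≢τ₃ τ₂≢τ₄ τ₃≢τ₄)

    first-Π : ∀ qs → First.FirstView (¬_ ∘ IsΠ) IsΠ qs ⊎ All (¬_ ∘ IsΠ) qs
    first-Π qs = Sum.map₁ toView (First.first (Sum.swap ∘ Dec.toSum ∘ IsΠ?) qs)

    Π-after : ∀ {q} xs y ys → All (¬_ ∘ IsΠ) xs → q ∈ xs ++ y ∷ ys → IsΠ q → q ≡ y ⊎ q ∈ ys
    Π-after xs y ys ∉Π q∈ π with ∈-++⁻ xs q∈
    ... | inj₁ q∈xs = ⊥-elim (All.lookup ∉Π q∈xs π)
    ... | inj₂ (here q≡y) = inj₁ q≡y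
    ... | inj₂ (there q∈ys) = inj₂ q∈ys

    τv≢τtv : τv ≢ τtv
    τv≢τtv eq = tx≢vx (sym (blue-injectiveˡ eq))
    τv≢τvt : τv ≢ τvt
    τv≢τvt eq = ty≢vy (sym (blue-injectiveʳ eq))
    τtv≢τvt : τtv ≢ τvt
    τtv≢τvt eq = tx≢vx (blue-injectiveˡ eq)

    analyse : ∀ R → EulerianHere (τt ∷ R) → Analysis R
    analyse R eul with first-Π R
    ... | inj₂ ∉Π = ⊥-elim (All.lookup ∉Π (FromτT.τv∈ R eul) Π-τv)
    ... | inj₁ (First._++_∷_ {S₁} {τ₂} ∉Π₁ π₂ R₂) with first-Π R₂
    ...   | inj₂ ∉Π = ⊥-elim (τv≢τtv (trans (only-τ₂ (FromτT.τv∈ R eul) Π-τv) (sym (only-τ₂ (FromτT.τtv∈ R eul) Π-τtv))))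
      where
        only-τ₂ : ∀ {q} → q ∈ R → IsΠ q → q ≡ τ₂
        only-τ₂ q∈ π with Π-after S₁ τ₂ R₂ ∉Π₁ q∈ π
        ... | inj₁ q≡τ₂ = q≡τ₂
        ... | inj₂ q∈R₂ = ⊥-elim (All.lookup ∉Π q∈R₂ π)
    ...   | inj₁ (First._++_∷_ {S₂} {τ₃} ∉Π₂ π₃ R₃) with first-Π R₃
    ...     | inj₂ ∉Π = ⊥-elim (pigeonhole′ (τ₂-or-τ₃ (FromτT.τv∈ R eul) Π-τv) (τ₂-or-τ₃ (FromτT.τtv∈ R eul) Π-τtv) (τ₂-or-τ₃ (FromτT.τvt∈ R eul) Π-τvt))
      where
        τ₂-or-τ₃ : ∀ {q} → q ∈ R → IsΠ q → q ≡ τ₂ ⊎ q ≡ τ₃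
        τ₂-or-τ₃ q∈ π with Π-after S₁ τ₂ _ ∉Π₁ q∈ π
        ... | inj₁ q≡τ₂ = inj₁ q≡τ₂
        ... | inj₂ q∈R₂ with Π-after S₂ τ₃ R₃ ∉Π₂ q∈R₂ π
        ...   | inj₁ q≡τ₃ = inj₂ q≡τ₃
        ...   | inj₂ q∈R₃ = ⊥-elim (All.lookup ∉Π q∈R₃ π)
        pigeonhole′ : τv ≡ τ₂ ⊎ τv ≡ τ₃ → τtv ≡ τ₂ ⊎ τtv ≡ τ₃ → τvt ≡ τ₂ ⊎ τvt ≡ τ₃ → ⊥
        pigeonhole′ (inj₁ p) (inj₁ q) _ = τv≢τtv (trans p (sym q))
        pigeonhole′ (inj₂ p) (inj₂ q) _ = τv≢τtv (trans p (sym q))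
        pigeonhole′ (inj₁ p) _ (inj₁ q) = τv≢τvt (trans p (sym q))
        pigeonhole′ (inj₂ p) _ (inj₂ q) = τv≢τvt (trans p (sym q))
        pigeonhole′ _ (inj₁ p) (inj₁ q) = τtv≢τvt (trans p (sym q))
        pigeonhole′ _ (inj₂ p) (inj₂ q) = τtv≢τvt (trans p (sym q))
    ...     | inj₁ (First._++_∷_ {S₃} {τ₄} ∉Π₃ π₄ S₄) = FourΠ.analysis S₁ τ₂ S₂ τ₃ S₃ τ₄ S₄ eul ∉Π₁ ∉Π₂ ∉Π₃ π₂ π₃ π₄

    from-τt : ∀ {ws} → EulerianHere ws → ∃₂ λ xs ys → ws ≡ xs ++ τt ∷ ys × Analysis (ys ++ xs)
    from-τt {ws} eul with first-occurrence {τt} {ws} (cnt≡1⇒∈ (trans (proj₂ eul τt) (cong mult (Π-blue is-τt))))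
    ... | xs , ys , refl , _ = xs , ys , refl , analyse (ys ++ xs) (Eulerian.eulerian-++-comm _≟Q_ qsrc qtgt xs (τt ∷ ys) eul)

    kept₁ kept₂ : Bool → QEdge m
    kept₁ true = τtv
    kept₁ false = τv
    kept₂ true = τvt
    kept₂ false = τt

    split-Π : ∀ b {e f} → tgt e ≡ a⋆ → src f ≡ a⋆ → split b (blue e f) ≡ Node.colour a⋆ (just b) e f
    split-Π b {e} {f} te sf = begin
      split b (blue e f)                                              ≡⟨ Wc-linked m ≤-refl (b ∷ bs′) (trans te (sym sf)) ⟩
      Node.colour (tgt e) (decided m ≤-refl (b ∷ bs′) (tgt e)) e f    ≡⟨ cong (λ a → Node.colour a (decided m ≤-refl (b ∷ bs′) a) e f) te ⟩
      Node.colour a⋆ (decided m ≤-refl (b ∷ bs′) a⋆) e f              ≡⟨ cong (λ d → Node.colour a⋆ d e f) (decided-a⋆ b bs′) ⟩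
      Node.colour a⋆ (just b) e f                                     ∎
      where open ≡-Reasoning

    kept-blk : ∀ b → split b (kept₁ b) ≡ blk × split b (kept₂ b) ≡ blk
    kept-blk true = trans (split-Π true (proj₁ t∈⋆) (proj₂ v∈⋆)) (Node.colour-tv a⋆ true) ,
                    trans (split-Π true (proj₁ v∈⋆) (proj₂ t∈⋆)) (Node.colour-vt a⋆ true)
    kept-blk false = trans (split-Π false (proj₁ v∈⋆) (proj₂ v∈⋆)) (Node.colour-v a⋆ false) ,
                     trans (split-Π false (proj₁ t∈⋆) (proj₂ t∈⋆)) (Node.colour-t a⋆ false)

    kept-Π : ∀ b → IsΠ (kept₁ b) × IsΠ (kept₂ b)
    kept-Π true = Π-τtv , Π-τvt
    kept-Π false = Π-τv , Π-τt

    kept-distinct : ∀ b → kept₁ b ≢ kept₂ b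
    kept-distinct true = τtv≢τvt
    kept-distinct false eq = tx≢vx (sym (blue-injectiveˡ eq))

    only-kept : ∀ b q → Present (split b) q → IsΠ q → q ≡ kept₁ b ⊎ q ≡ kept₂ b
    only-kept b (blue e f) present te with tgt e ≟F src f
    ... | no unlinked = ⊥-elim (present (Wc-unlinked m ≤-refl (b ∷ bs′) unlinked))
    ... | yes linked with in-edge te | out-edge (trans (sym linked) te) | b
    ...   | inj₁ refl | inj₁ refl | false = inj₂ refl
    ...   | inj₁ refl | inj₁ refl | true = ⊥-elim (present (trans (split-Π true te (proj₂ t∈⋆)) (Node.colour-t a⋆ true)))
    ...   | inj₂ refl | inj₂ refl | false = inj₁ refl
    ...   | inj₂ refl | inj₂ refl | true = ⊥-elim (present (trans (split-Π true te (proj₂ v∈⋆)) (Node.colour-v a⋆ true)))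
    ...   | inj₁ refl | inj₂ refl | true = inj₁ refl
    ...   | inj₁ refl | inj₂ refl | false = ⊥-elim (present (trans (split-Π false te (proj₂ v∈⋆)) (Node.colour-tv a⋆ false)))
    ...   | inj₂ refl | inj₁ refl | true = inj₂ refl
    ...   | inj₂ refl | inj₁ refl | false = ⊥-elim (present (trans (split-Π false te (proj₂ t∈⋆)) (Node.colour-vt a⋆ false)))

    kept₁-tgt : ∀ b → qtgt (kept₁ b) ≡ (vy , minus)
    kept₁-tgt true = refl
    kept₁-tgt false = refl

    into-ty⁻ : ∀ b {q} → Present (split b) q → qtgt q ≡ (ty , minus) → q ≡ kept₂ b
    into-ty⁻ b {blue e f} present refl with tgt e ≟F src f
    ... | no unlinked = ⊥-elim (present (Wc-unlinked m ≤-refl (b ∷ bs′) unlinked))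
    ... | yes linked with only-kept b (blue e ty) present (trans linked (proj₂ t∈⋆))
    ...   | inj₂ q≡kept₂ = q≡kept₂
    ...   | inj₁ q≡kept₁ = ⊥-elim (ty≢vy (cong proj₁ (trans (cong qtgt q≡kept₁) (kept₁-tgt b))))

    split-cycle : Bool → List (QEdge m) → List (QEdge m) → List (QEdge m)
    split-cycle b S₁ S₂ = S₁ ++ kept₁ b ∷ S₂ ∷ʳ kept₂ b

    decompose : ∀ b Y → Walk (ty , minus) Y (ty , minus) → (∀ {q} → q ∈ Y → Present (split b) q) →
                cnt (kept₁ b) Y ≡ 1 → cnt (kept₂ b) Y ≡ 1 →
                ∃₂ λ S₁ S₂ → Y ≡ split-cycle b S₁ S₂ × All (¬_ ∘ IsΠ) S₁ × All (¬_ ∘ IsΠ) S₂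
    decompose b Y walk present once₁ once₂ with List.initLast Y
    ... | List.[] = ⊥-elim (case cnt≡1⇒∈ {x = kept₁ b} {xs = []} once₁ of λ ())
    ... | Y′ List.∷ʳ′ l with into-ty⁻ b (present (∈-++⁺ʳ Y′ (here refl))) (proj₂ (walk-split Y′ l [] walk))
    ...   | refl with first-Π Y′
    ...     | inj₂ ∉Π = ⊥-elim (All.lookup ∉Π (cnt≡1⇒∈ kept₁-once) (proj₁ (kept-Π b)))
      where
        kept₁-once : cnt (kept₁ b) Y′ ≡ 1
        kept₁-once = trans (sym (cnt-there Y′ (kept-distinct b))) (trans (sym (cnt-∷ʳ (kept₁ b) Y′ (kept₂ b))) once₁)
    ...     | inj₁ (First._++_∷_ {S₁} {κ} ∉Π₁ πκ S₂) with only-kept b κ (present (∈-++⁺ˡ (∈-++⁺ʳ S₁ (here refl)))) πκ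
    ...       | inj₂ refl = ⊥-elim (kept₂-absent (∈-++⁺ʳ S₁ (here refl)))
      where
        kept₂-absent : kept₂ b ∈ S₁ ++ kept₂ b ∷ S₂ → ⊥
        kept₂-absent kept₂∈ = <⇒≢ (s≤s (∈⇒1≤cnt kept₂∈)) (sym (trans (sym (trans (cnt-∷ʳ (kept₂ b) (S₁ ++ kept₂ b ∷ S₂) (kept₂ b)) (cnt-here (kept₂ b) (S₁ ++ kept₂ b ∷ S₂)))) once₂))
    ...       | inj₁ refl = S₁ , S₂ , ++-assoc S₁ (kept₁ b ∷ S₂) [ kept₂ b ] , ∉Π₁ , All.tabulate ∉Π₂
      where
        Z : List (QEdge m)
        Z = S₁ ++ kept₁ b ∷ S₂
        kept₂-absent : kept₂ b ∈ Z → ⊥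
        kept₂-absent kept₂∈ = <⇒≢ (s≤s (∈⇒1≤cnt kept₂∈)) (sym (trans (sym (trans (cnt-∷ʳ (kept₂ b) Z (kept₂ b)) (cnt-here (kept₂ b) Z))) once₂))
        ∉Π₂ : ∀ {q} → q ∈ S₂ → ¬ IsΠ q
        ∉Π₂ {q} q∈ π with only-kept b q (present (∈-++⁺ˡ (∈-++⁺ʳ S₁ (there q∈)))) π
        ... | inj₂ refl = kept₂-absent (∈-++⁺ʳ S₁ (there q∈))
        ... | inj₁ refl = <⇒≢ (≤-trans (∈⇒2≤cnt (kept₁ b) S₁ S₂ q∈) (≤-reflexive kept₁-once)) refl
          where
            kept₁-once : cnt (kept₁ b) Z ≡ 1
            kept₁-once = trans (sym (cnt-there Z (kept-distinct b))) (trans (sym (cnt-∷ʳ (kept₁ b) Z (kept₂ b))) once₁)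

    Π-count : QEdge m → ℕ
    Π-count q = cnt q [ τt ] + cnt q [ τtv ] + cnt q [ τv ] + cnt q [ τvt ]

    cnt-shape : ∀ b S₁ S₂ q → cnt q (shape b S₁ S₂) ≡ Π-count q + ((cnt q S₁ + cnt q S₂) + (cnt q S₁ + cnt q S₂))
    cnt-shape true S₁ S₂ q = trans (cnt-blocks q τt τtv τv τvt S₁ S₂ S₂ S₁)
      (solve 6 (λ a b c d x y → a :+ (x :+ (b :+ (y :+ (c :+ (y :+ (d :+ x)))))) := a :+ b :+ c :+ d :+ ((x :+ y) :+ (x :+ y))) refl
        (cnt q [ τt ]) (cnt q [ τtv ]) (cnt q [ τv ]) (cnt q [ τvt ]) (cnt q S₁) (cnt q S₂))
      where open +-*-Solver
    cnt-shape false S₁ S₂ q = trans (cnt-blocks q τt τvt τv τtv S₁ S₁ S₂ S₂)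
      (solve 6 (λ a b c d x y → a :+ (x :+ (d :+ (x :+ (c :+ (y :+ (b :+ y)))))) := a :+ b :+ c :+ d :+ ((x :+ y) :+ (x :+ y))) refl
        (cnt q [ τt ]) (cnt q [ τtv ]) (cnt q [ τv ]) (cnt q [ τvt ]) (cnt q S₁) (cnt q S₂))
      where open +-*-Solver

    τt≢τv : τt ≢ τv
    τt≢τv eq = tx≢vx (blue-injectiveˡ eq)
    τt≢τtv : τt ≢ τtv
    τt≢τtv eq = ty≢vy (blue-injectiveʳ eq)
    τt≢τvt : τt ≢ τvt
    τt≢τvt eq = tx≢vx (blue-injectiveˡ eq)

    Π-count-present : ∀ {q} → PresentΠ q → Π-count q ≡ 1
    Π-count-present is-τt = cong₂ _+_ (cong₂ _+_ (cong₂ _+_ (cnt-here τt []) (cnt-[-] τt≢τtv)) (cnt-[-] τt≢τv)) (cnt-[-] τt≢τvt)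
    Π-count-present is-τtv = cong₂ _+_ (cong₂ _+_ (cong₂ _+_ (cnt-[-] (τt≢τtv ∘ sym)) (cnt-here τtv [])) (cnt-[-] (τv≢τtv ∘ sym))) (cnt-[-] τtv≢τvt)
    Π-count-present is-τv = cong₂ _+_ (cong₂ _+_ (cong₂ _+_ (cnt-[-] (τt≢τv ∘ sym)) (cnt-[-] τv≢τtv)) (cnt-here τv [])) (cnt-[-] τv≢τvt)
    Π-count-present is-τvt = cong₂ _+_ (cong₂ _+_ (cong₂ _+_ (cnt-[-] (τt≢τvt ∘ sym)) (cnt-[-] (τtv≢τvt ∘ sym))) (cnt-[-] (τv≢τvt ∘ sym))) (cnt-here τvt [])

    Π-count-Π : ∀ {q} → IsΠ q → Π-count q ≡ mult (c′ q)
    Π-count-Π {blue e f} te with tgt e ≟F src f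
    ... | yes linked = trans (Π-count-present π) (sym (cong mult (Π-blue π)))
      where
        π : PresentΠ (blue e f)
        π = present-Π (blue e f) (λ absent≡ → case trans (sym (c′-Π te (trans (sym linked) te))) absent≡ of λ ()) te
    ... | no unlinked = trans (cong₂ _+_ (cong₂ _+_ (cong₂ _+_ (cnt-[-] (≢τ t∈⋆)) (cnt-[-] (≢τ (proj₁ t∈⋆ , proj₂ v∈⋆))))
                                                  (cnt-[-] (≢τ v∈⋆))) (cnt-[-] (≢τ (proj₁ v∈⋆ , proj₂ t∈⋆))))
                              (sym (cong mult (Wc-unlinked k k≤m bs′ unlinked)))
      where
        ≢τ : ∀ {e′ f′} → tgt e′ ≡ a⋆ × src f′ ≡ a⋆ → blue e f ≢ blue e′ f′
        ≢τ (te′ , sf′) refl = unlinked (trans te′ (sym sf′))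

    well-shaped : ∀ b {S₁ S₂} → Walk (ty , minus) S₁ (qsrc (kept₁ b)) → Walk (qtgt (kept₁ b)) S₂ (qsrc (kept₂ b)) →
                  All Free S₁ → All Free S₂ → WellShaped b S₁ S₂
    well-shaped true walk₁ walk₂ free₁ free₂ = (walk₁ , free₁) , (walk₂ , free₂)
    well-shaped false walk₁ walk₂ free₁ free₂ = (walk₁ , free₁) , (walk₂ , free₂)

    cnt-split-cycle : ∀ b S₁ S₂ {q} → ¬ IsΠ q → cnt q (split-cycle b S₁ S₂) ≡ cnt q S₁ + cnt q S₂
    cnt-split-cycle b S₁ S₂ {q} ∉Π = begin
      cnt q (S₁ ++ kept₁ b ∷ S₂ ∷ʳ kept₂ b)                       ≡⟨ cnt-++ q S₁ _ ⟩
      cnt q S₁ + cnt q (kept₁ b ∷ S₂ ∷ʳ kept₂ b)                  ≡⟨ cong (cnt q S₁ +_) (cnt-there (S₂ ∷ʳ kept₂ b) (≢kept (proj₁ (kept-Π b)))) ⟩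
      cnt q S₁ + cnt q (S₂ ∷ʳ kept₂ b)                            ≡⟨ cong (cnt q S₁ +_) (cnt-∷ʳ q S₂ (kept₂ b)) ⟩
      cnt q S₁ + cnt q (kept₂ b ∷ S₂)                             ≡⟨ cong (cnt q S₁ +_) (cnt-there S₂ (≢kept (proj₂ (kept-Π b)))) ⟩
      cnt q S₁ + cnt q S₂                                         ∎
      where
        open ≡-Reasoning
        ≢kept : ∀ {κ} → IsΠ κ → q ≢ κ
        ≢kept π refl = ∉Π π

    module Existence (b : Bool) (connected : Connected (split b)) where
      private
        module W = MemberOfWm (b ∷ bs′)
        spanning : W.Spanning
        spanning = W.connected⇒spanning connected
        X : List (QEdge m)
        X = W.σ-orbit
        X-split : ∃₂ λ P Q → X ≡ P ++ black ty ∷ Q × cnt (black ty) P ≡ 0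
        X-split = first-occurrence (W.spanning⇒∈σ-orbit spanning (W.black-present ty))
        P Q : List (QEdge m)
        P = proj₁ X-split
        Q = proj₁ (proj₂ X-split)
        X≡ : X ≡ P ++ black ty ∷ Q
        X≡ = proj₁ (proj₂ (proj₂ X-split))

      Y : List (QEdge m)
      Y = black ty ∷ Q ++ P

      cnt-Y : ∀ q → cnt q Y ≡ cnt q X
      cnt-Y q = trans (cnt-++-comm q (black ty ∷ Q) P) (cong (cnt q) (sym X≡))

      Y-walk : Walk (ty , minus) Y (ty , minus)
      Y-walk = closed⇒walk (black ty) (Q ++ P) (closed-++-comm P (black ty ∷ Q) (subst (ClosedWalk qsrc qtgt) X≡ W.σ-orbit-closed))

      Y-present : ∀ {q} → q ∈ Y → Present (split b) q
      Y-present {q} q∈ = W.σ-orbit-present (1≤cnt⇒∈ (subst (1 ≤_) (cnt-Y q) (∈⇒1≤cnt q∈)))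

      blk-once : ∀ q → split b q ≡ blk → cnt q Y ≡ 1
      blk-once q blk≡ = trans (cnt-Y q) (Orbits.cnt-orbit _≟Q_ W.σ W.σ-period′ (W.spanning⇒∈σ-orbit spanning λ absent≡ → case trans (sym blk≡) absent≡ of λ ()))

      private
        parts : ∃₂ λ S₁ S₂ → Y ≡ split-cycle b S₁ S₂ × All (¬_ ∘ IsΠ) S₁ × All (¬_ ∘ IsΠ) S₂
        parts = decompose b Y Y-walk Y-present (blk-once (kept₁ b) (proj₁ (kept-blk b))) (blk-once (kept₂ b) (proj₂ (kept-blk b)))

      S₁ S₂ : List (QEdge m)
      S₁ = proj₁ parts
      S₂ = proj₁ (proj₂ parts)

      Y≡ : Y ≡ split-cycle b S₁ S₂
      Y≡ = proj₁ (proj₂ (proj₂ parts))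

      shaped : WellShaped b S₁ S₂
      shaped = well-shaped b (proj₁ walk₁) (proj₁ (walk-split S₂ (kept₂ b) [] (proj₂ walk₁)))
                 (free ∈-++⁺ˡ (proj₁ (proj₂ (proj₂ (proj₂ parts)))))
                 (free (λ q∈ → ∈-++⁺ʳ S₁ (there (∈-++⁺ˡ q∈))) (proj₂ (proj₂ (proj₂ (proj₂ parts)))))
        where
          walk₁ : Walk (ty , minus) S₁ (qsrc (kept₁ b)) × Walk (qtgt (kept₁ b)) (S₂ ∷ʳ kept₂ b) (ty , minus)
          walk₁ = walk-split S₁ (kept₁ b) (S₂ ∷ʳ kept₂ b) (subst (λ Z → Walk (ty , minus) Z (ty , minus)) Y≡ Y-walk)
          free : ∀ {S} → (∀ {q} → q ∈ S → q ∈ split-cycle b S₁ S₂) → All (¬_ ∘ IsΠ) S → All Free S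
          free S⊆ ∉Π = All.tabulate λ {q} q∈ →
            (λ absent≡ → Y-present (subst (q ∈_) (sym Y≡) (S⊆ q∈)) (trans (sym (c′-split b q (All.lookup ∉Π q∈))) absent≡)) ,
            All.lookup ∉Π q∈

      eulerian : EulerianHere (shape b S₁ S₂)
      eulerian = shape-closed b shaped , λ q → counts q (IsΠ? q)
        where
          counts : ∀ q → Dec (IsΠ q) → cnt q (shape b S₁ S₂) ≡ mult (c′ q)
          counts q (yes π) = begin
            cnt q (shape b S₁ S₂)                                      ≡⟨ cnt-shape b S₁ S₂ q ⟩
            Π-count q + ((cnt q S₁ + cnt q S₂) + (cnt q S₁ + cnt q S₂)) ≡⟨ cong (λ k → Π-count q + (k + k)) (cong₂ _+_ (none S₁ (proj₁ (proj₂ (proj₂ (proj₂ parts))))) (none S₂ (proj₂ (proj₂ (proj₂ (proj₂ parts)))))) ⟩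
            Π-count q + 0                                              ≡⟨ +-identityʳ _ ⟩
            Π-count q                                                  ≡⟨ Π-count-Π π ⟩
            mult (c′ q)                                                ∎
            where
              open ≡-Reasoning
              none : ∀ S → All (¬_ ∘ IsΠ) S → cnt q S ≡ 0
              none S ∉Π = cnt≡0 {P = IsΠ} ∉Π π
          counts q (no ∉Π) = begin
            cnt q (shape b S₁ S₂)                                      ≡⟨ cnt-shape b S₁ S₂ q ⟩
            Π-count q + ((cnt q S₁ + cnt q S₂) + (cnt q S₁ + cnt q S₂)) ≡⟨ cong (_+ ((cnt q S₁ + cnt q S₂) + (cnt q S₁ + cnt q S₂))) Π-count≡0 ⟩
            (cnt q S₁ + cnt q S₂) + (cnt q S₁ + cnt q S₂)              ≡⟨ cong (λ k → k + k) (trans (sym (cnt-split-cycle b S₁ S₂ ∉Π)) (trans (cong (cnt q) (sym Y≡)) (cnt-Y q))) ⟩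
            cnt q X + cnt q X                                          ≡⟨ cnt-++ q X X ⟨
            cnt q W.doubled                                            ≡⟨ proj₂ (W.doubled-eulerian spanning) q ⟩
            mult (split b q)                                           ≡⟨ cong mult (c′-split b q ∉Π) ⟨
            mult (c′ q)                                                ∎
            where
              open ≡-Reasoning
              ≢τ : ∀ {τ} → IsΠ τ → q ≢ τ
              ≢τ π refl = ∉Π π
              Π-count≡0 : Π-count q ≡ 0
              Π-count≡0 = cong₂ _+_ (cong₂ _+_ (cong₂ _+_ (cnt-[-] (≢τ Π-τt)) (cnt-[-] (≢τ Π-τtv))) (cnt-[-] (≢τ Π-τv))) (cnt-[-] (≢τ Π-τvt))

    split-cycle-walk : ∀ b {S₁ S₂} → WellShaped b S₁ S₂ → Walk (ty , minus) (split-cycle b S₁ S₂) (ty , minus)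
    split-cycle-walk true {S₁} {S₂} ((walk₁ , _) , (walk₂ , _)) = walk-++ S₁ _ walk₁ (refl , walk-++ S₂ _ walk₂ (refl , refl))
    split-cycle-walk false {S₁} {S₂} ((walk₁ , _) , (walk₂ , _)) = walk-++ S₁ _ walk₁ (refl , walk-++ S₂ _ walk₂ (refl , refl))

    well-shaped⇒connected : ∀ b {S₁ S₂} → WellShaped b S₁ S₂ → (∀ e → black e ∈ S₁ ⊎ black e ∈ S₂) → Connected (split b)
    well-shaped⇒connected b {S₁} {S₂} shaped blacks =
      closed-walk⇒connected (split b) (split-cycle b S₁ S₂) (walk⇒closed _ (split-cycle-walk b shaped))
        (All.++⁺ (All.map free-in-split (proj₂ (proj₁ shaped)))
          (kept-present (kept₁ b) (proj₁ (kept-blk b)) ∷ All.++⁺ (All.map free-in-split (proj₂ (proj₂ shaped))) (kept-present (kept₂ b) (proj₂ (kept-blk b)) ∷ [])))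
        (λ e → Sum.[ ∈-++⁺ˡ , (λ e∈ → ∈-++⁺ʳ S₁ (there (∈-++⁺ˡ e∈))) ] (blacks e))
      where
        free-in-split : ∀ {q} → Free q → Present (split b) q
        free-in-split {q} (present , ∉Π) absent≡ = present (trans (c′-split b q ∉Π) absent≡)
        kept-present : ∀ q → split b q ≡ blk → Present (split b) q
        kept-present _ blk≡ absent≡ = case trans (sym blk≡) absent≡ of λ ()

    shape-blacks : ∀ b S₁ S₂ {e} → black e ∈ shape b S₁ S₂ → black e ∈ S₁ ⊎ black e ∈ S₂
    shape-blacks true S₁ S₂ (there e∈) with ∈-++⁻ S₁ e∈
    ... | inj₁ e∈₁ = inj₁ e∈₁
    ... | inj₂ (there e∈′) with ∈-++⁻ S₂ e∈′
    ...   | inj₁ e∈₂ = inj₂ e∈₂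
    ...   | inj₂ (there e∈″) with ∈-++⁻ S₂ e∈″
    ...     | inj₁ e∈₂ = inj₂ e∈₂
    ...     | inj₂ (there e∈₁) = inj₁ e∈₁
    shape-blacks false S₁ S₂ (there e∈) with ∈-++⁻ S₁ e∈
    ... | inj₁ e∈₁ = inj₁ e∈₁
    ... | inj₂ (there e∈′) with ∈-++⁻ S₁ e∈′
    ...   | inj₁ e∈₁ = inj₁ e∈₁
    ...   | inj₂ (there e∈″) with ∈-++⁻ S₂ e∈″
    ...     | inj₁ e∈₂ = inj₂ e∈₂
    ...     | inj₂ (there e∈₂) = inj₂ e∈₂

    module CycleOfWm-1 (ws : List (QEdge m)) (eul : EulerianHere ws) where
      private
        r : ∃₂ λ xs ys → ws ≡ xs ++ τt ∷ ys × Analysis (ys ++ xs)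
        r = from-τt {ws} eul
        analysis : Analysis (proj₁ (proj₂ r) ++ proj₁ r)
        analysis = proj₂ (proj₂ (proj₂ r))
      xs ys : List (QEdge m)
      xs = proj₁ r
      ys = proj₁ (proj₂ r)

      ws≡ : ws ≡ xs ++ τt ∷ ys
      ws≡ = proj₁ (proj₂ (proj₂ r))

      b : Bool
      b = proj₁ analysis

      S₁ S₂ : List (QEdge m)
      S₁ = proj₁ (proj₂ analysis)
      S₂ = proj₁ (proj₂ (proj₂ analysis))

      shape≡ : τt ∷ ys ++ xs ≡ shape b S₁ S₂
      shape≡ = proj₁ (proj₂ (proj₂ (proj₂ analysis)))

      shaped : WellShaped b S₁ S₂
      shaped = proj₂ (proj₂ (proj₂ (proj₂ analysis)))

      shape-eulerian : EulerianHere (shape b S₁ S₂)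
      shape-eulerian = subst EulerianHere shape≡ (Eulerian.eulerian-++-comm _≟Q_ qsrc qtgt xs (τt ∷ ys) (subst EulerianHere ws≡ eul))

      connected : Connected (split b)
      connected = well-shaped⇒connected b shaped λ e →
        shape-blacks b S₁ S₂ (cnt≡2⇒∈ (trans (proj₂ shape-eulerian (black e)) (cong mult (Wc-black k k≤m bs′ e))))

  Wm-1-classification : Classification (ΘW k k≤m) Classes
  Wm-1-classification = record
    { class = λ (bs′ , _ , ws , eul) → CycleOfWm-1.b bs′ ws eul ∷ bs′ , CycleOfWm-1.connected bs′ ws eul
    ; class-cong = class-cong
    ; class-injective = class-injective
    ; representative = λ { (b ∷ bs′ , connected) → bs′ , tt , shape bs′ b (S₁ bs′ b connected) (S₂ bs′ b connected) , eulerian bs′ b connected }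
    ; class-representative = λ { (b ∷ bs′ , connected) →
        cong (_∷ bs′) (proj₁ (well-shaped-unique bs′ (CycleOfWm-1.shaped bs′ (shape bs′ b (S₁ bs′ b connected) (S₂ bs′ b connected)) (eulerian bs′ b connected)) (shaped bs′ b connected))) }
    }
    where
      open MemberOfWm-1 using (well-shaped-unique; shape; module CycleOfWm-1)
      open MemberOfWm-1.Existence using (S₁; S₂; shaped; eulerian)
      open FamilyRotations (λ _ → ⊤) (λ bs′ → mult ∘ Wc k k≤m bs′)
      S : Setoid 0ℓ 0ℓ
      S = ΘW k k≤m
      vector : Setoid.Carrier S → Vec Bool m
      vector (bs′ , _ , ws , eul) = CycleOfWm-1.b bs′ ws eul ∷ bs′
      class-cong : ∀ {x y} → Setoid._≈_ S x y → vector x ≡ vector y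
      class-cong {bs′ , _ , ws , eul} {_ , _ , ws′ , eul′} x≈y with ΘFam-index x≈y
      ... | refl = cong (_∷ bs′) (proj₁ (well-shaped-unique bs′ (CycleOfWm-1.shaped bs′ ws eul) (CycleOfWm-1.shaped bs′ ws′ eul′)))
      to-shape : ∀ bs′ ws (eul : MemberOfWm-1.EulerianHere bs′ ws) →
                 RotationEquivalent bs′ ws (shape bs′ (CycleOfWm-1.b bs′ ws eul) (CycleOfWm-1.S₁ bs′ ws eul) (CycleOfWm-1.S₂ bs′ ws eul))
      to-shape bs′ ws eul = ≈-resp-≡ (sym (CycleOfWm-1.ws≡ bs′ ws eul)) (CycleOfWm-1.shape≡ bs′ ws eul)
        (rotate-to-≈ (CycleOfWm-1.xs bs′ ws eul) τt (CycleOfWm-1.ys bs′ ws eul))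
      class-injective : ∀ {x y} → vector x ≡ vector y → Setoid._≈_ S x y
      class-injective {bs′ , _ , ws , eul} {_ , _ , ws′ , eul′} eq with Vec.∷-injectiveʳ eq
      ... | refl with well-shaped-unique bs′ (CycleOfWm-1.shaped bs′ ws eul) (CycleOfWm-1.shaped bs′ ws′ eul′)
      ...   | b≡ , S₁≡ , S₂≡ = RotationEquivalent-trans (tt , CycleOfWm-1.shape-eulerian bs′ ws′ eul′)
                                 (≈-resp-≡ refl (trans (cong₂ (shape bs′ _) S₁≡ S₂≡) (cong (λ b → shape bs′ b _ _) b≡)) (to-shape bs′ ws eul))
                                 (RotationEquivalent-sym (to-shape bs′ ws′ eul′)) (tt , eul) (tt , eul′)

proposition4 : ∀ {m : ℕ} (N : TNet m) (L : ∀ a → Labelling N a) (φ : Fin m ⤖ Fin m) →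
    1 ≤ m →
    let open Construction N L φ
        Wm-1 = ΘW (m ∸ 1) (m∸n≤m m 1)
        Wm = ΘW m ≤-refl
    in Bijection ΘN ΘΔ × Bijection ΘN Wm-1 × Bijection ΘN Wm ×
       Bijection ΘΔ Wm-1 × Bijection ΘΔ Wm × Bijection Wm-1 Wm
proposition4 {suc k} N L φ _ =
  bijection-via ΘN-classification Δ-classification ,
  bijection-via ΘN-classification Wm-1-classification ,
  bijection-via ΘN-classification Wm-classification ,
  bijection-via Δ-classification Wm-1-classification ,
  bijection-via Δ-classification Wm-classification ,
  bijection-via Wm-1-classification Wm-classification
  where open TNetCycles N L φ
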